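{- Let $q\ge p\ge 3$ be coprime integers and let $$Q_{\{p,q\}}(x)=\frac{(1-x^{pq})(1-x)}{(1-x^p)(1-x^q)},$$ which is a polynomial of degree $(p-1)(q-1)$. Define $r_0=p$, $r_1=\langle q\rangle_p$, and for $1\le i\le t$ define integers $Z_i$, $r_{i+1}$ by $r_{i-1}=Z_ir_i+r_{i+1}$, $0\le r_{i+1}<r_i$, where $t$ is the index with $r_t=1$ (so $r_{t+1}=0$ and $Z_t=r_{t-1}$). Put $$G_i=\{\,r_{i-1}-zr_i-1 : 0\le z\le Z_i-1\,\}\quad (1\le i\le t-1),$$ $$G_t=\{\,r_{t-1}-zr_t-1 : 0\le z\le Z_t-2\,\}=\{1,2,\dots,r_{t-1}-1\}.$$ Then the gapset of $Q_{\{p,q\}}$ satisfies $$G(Q_{\{p,q\}})=\bigcup_{i=1}^t G_i,$$ and $$\#G(Q_{\{p,q\}})=\sum_{i=1}^t\lfloor r_{i-1}/r_i\rfloor-1.$$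
   Context: $\langle x\rangle_p$ denotes the least nonnegative residue of $x$ modulo $p$. For a polynomial $f$ with at least two nonzero coefficients, written as $f(x)=c_1x^{e_1}+\dots+c_kx^{e_k}$ with all $c_i\ne0$ and $0\le e_1<e_2<\dots<e_k$, its gapset is $G(f)=\{e_{i+1}-e_i : 1\le i\le k-1\}$. Note $Z_i=\lfloor r_{i-1}/r_i\rfloor$. -}

module Defs where

open import Data.Nat as ℕ using (ℕ; zero; suc; _≡ᵇ_; _<_; _≤_; _∸_)
open import Data.Integer as ℤ using (ℤ; 0ℤ; 1ℤ; -_; _+_; _*_)
open import Data.Bool using (if_then_else_)
open import Data.List using (List; applyUpTo)
open import Data.Nat.ListAction using (sum)
open import Data.Product using (∃; ∃-syntax; _×_)
open import Relation.Binary.PropositionalEquality using (_≡_; _≢_)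

Poly : Set
Poly = ℕ → ℤ

X^ : ℕ → Poly
X^ k n = if n ≡ᵇ k then 1ℤ else 0ℤ

1-X^ : ℕ → Poly
1-X^ k n = X^ 0 n + (- X^ k n)

Σ≤ : ℕ → (ℕ → ℤ) → ℤ
Σ≤ zero    g = g 0
Σ≤ (suc n) g = Σ≤ n g + g (suc n)

_⊛_ : Poly → Poly → Poly
(a ⊛ b) n = Σ≤ n (λ i → a i * b (n ∸ i))

Num : ℕ → ℕ → Poly
Num p q = 1-X^ (p ℕ.* q) ⊛ 1-X^ 1

Den : ℕ → ℕ → Poly
Den p q = 1-X^ p ⊛ 1-X^ q

-- f is Q_{p,q}: f · (1-x^p)(1-x^q) = (1-x^{pq})(1-x) coefficientwise.
-- (Since the denominator has constant term 1, f is uniquely determined.)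
IsQ : ℕ → ℕ → Poly → Set
IsQ p q f = ∀ n → (f ⊛ Den p q) n ≡ Num p q n

InGapset : Poly → ℕ → Set
InGapset f g = ∃[ e ] ∃[ e' ] (e < e' × f e ≢ 0ℤ × f e' ≢ 0ℤ
  × (∀ k → e < k → k < e' → f k ≡ 0ℤ) × g ≡ e' ∸ e)

ΣZ : (ℕ → ℕ) → ℕ → ℕ
ΣZ Z t = sum (applyUpTo (λ i → Z (suc i)) t)

-- Let S = ⟨p, q⟩. Since S is the disjoint union of p + S and its Apéry set {0, q, …, (p - 1) q},
-- (1 - x^p)(1 - x^q) Σ_{s ∈ S} x^s = 1 - x^{pq}, so Q_{p,q} = (1 - x) Σ_{s ∈ S} x^s: the nonzero
-- coefficients of Q_{p,q} sit exactly where membership in S changes. Under the symmetry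
-- n ↦ pq - p - q - n, which exchanges S and its complement, runs of S become holes, so the gaps of
-- Q_{p,q} are the numbers d - 1 for the distances d ≥ 2 between consecutive elements of S.
-- Writing n ≡ j q (mod p) with j < p, n ∈ S iff j q ≤ n; hence such a distance is the least residue
-- of ± δ q (mod p) over a range 1 ≤ δ ≤ δ₀, and the best-approximation property of the Euclidean
-- algorithm on (p, q mod p) identifies these least residues with the values r (i - 1) - z r i.

module Submission where

open import Data.Nat.Base as ℕ using (ℕ; zero; suc; z≤n; s≤s; _≤_; _<_; _∸_)
import Data.Nat.Properties as ℕ
import Data.Nat.Divisibility as ℕ
open import Data.Integer.Base as ℤ using (ℤ; +_; -[1+_]; 0ℤ; 1ℤ; ∣_∣)
import Data.Integer.Properties as ℤ
open import Data.Integer.Divisibility.Signed as Signed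
  using (_∣_; divides; ∣⇒∣ᵤ; ∣m∣n⇒∣m+n; ∣m⇒∣-m; ∣n⇒∣m*n)
open import Data.Integer.Tactic.RingSolver using (solve-∀)
import Data.Nat.Tactic.RingSolver as NS
open import Data.Product using (∃; ∃-syntax; _×_; _,_; proj₁; proj₂)
open import Data.Sum using (_⊎_; inj₁; inj₂; [_,_])
import Data.Sum
open import Data.Bool.Base using (if_then_else_)
open import Data.Empty using (⊥; ⊥-elim)
open import Function.Base using (_∘_)
open import Function.Bundles using (_⇔_; mk⇔; Equivalence)
import Function.Properties.Equivalence as ⇔
open import Relation.Nullary using (¬_; Dec; yes; no; does)
open import Relation.Nullary.Decidable using (dec-true; dec-false)
open import Level using (0ℓ)
open import Relation.Binary.Bundles using (Setoid)
open import Relation.Binary.Structures using (IsEquivalence)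
open import Relation.Binary.Definitions using (tri<; tri≈; tri>)
open import Data.Nat.Coprimality using (Coprime; coprime-Bézout)
open import Data.Nat.GCD using (module Bézout)
open import Relation.Binary.PropositionalEquality hiding ([_])

open import Defs

module Casts where
  open import Data.Integer.Base using (_+_; _*_; _-_)

  pos-∸ : ∀ {m n} → n ≤ m → + (m ∸ n) ≡ + m - + n
  pos-∸ {m} {n} n≤m = sym (trans (ℤ.[+m]-[+n]≡m⊖n m n) (ℤ.⊖-≥ n≤m))

  pos-+-* : ∀ a b c → + (a ℕ.+ b ℕ.* c) ≡ + a + + b * + c
  pos-+-* a b c = trans (ℤ.pos-+ a (b ℕ.* c)) (cong (λ x → + a + x) (ℤ.pos-* b c))

  pos-*-+-* : ∀ a b c d → + (a ℕ.* b ℕ.+ c ℕ.* d) ≡ + a * + b + + c * + d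
  pos-*-+-* a b c d = trans (ℤ.pos-+ (a ℕ.* b) (c ℕ.* d)) (cong₂ _+_ (ℤ.pos-* a b) (ℤ.pos-* c d))

module Modular (p : ℕ) where
  open import Data.Integer.Base using (_+_; _*_; -_; _-_)

  infix 4 _≈_
  record _≈_ (a b : ℤ) : Set where
    constructor congruence
    field divides-difference : + p ∣ a - b

  ≈-reflexive : ∀ {a b} → a ≡ b → a ≈ b
  ≈-reflexive {a} refl = congruence (divides 0ℤ (ℤ.+-inverseʳ a))

  ≈-refl : ∀ {a} → a ≈ a
  ≈-refl = ≈-reflexive refl

  ≈-sym : ∀ {a b} → a ≈ b → b ≈ a
  ≈-sym {a} {b} (congruence p∣a-b) = congruence (subst (+ p ∣_) (negate-minus a b) (∣m⇒∣-m p∣a-b))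
    where
    negate-minus : ∀ a b → - (a - b) ≡ b - a
    negate-minus = solve-∀

  ≈-trans : ∀ {a b c} → a ≈ b → b ≈ c → a ≈ c
  ≈-trans {a} {b} {c} (congruence p∣a-b) (congruence p∣b-c) =
    congruence (subst (+ p ∣_) (ℤ.+-minus-telescope a b c) (∣m∣n⇒∣m+n p∣a-b p∣b-c))

  ≈-isEquivalence : IsEquivalence _≈_
  ≈-isEquivalence = record { refl = ≈-refl ; sym = ≈-sym ; trans = ≈-trans }

  ≈-setoid : Setoid 0ℓ 0ℓ
  ≈-setoid = record { isEquivalence = ≈-isEquivalence }

  +-cong : ∀ {a b c d} → a ≈ b → c ≈ d → a + c ≈ b + d
  +-cong {a} {b} {c} {d} (congruence p∣a-b) (congruence p∣c-d) =
    congruence (subst (+ p ∣_) (interchange a b c d) (∣m∣n⇒∣m+n p∣a-b p∣c-d))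
    where
    interchange : ∀ a b c d → (a - b) + (c - d) ≡ (a + c) - (b + d)
    interchange = solve-∀

  -‿cong : ∀ {a b} → a ≈ b → - a ≈ - b
  -‿cong {a} {b} (congruence p∣a-b) = congruence (subst (+ p ∣_) (negate-minus a b) (∣m⇒∣-m p∣a-b))
    where
    negate-minus : ∀ a b → - (a - b) ≡ - a - - b
    negate-minus = solve-∀

  minus-cong : ∀ {a b c d} → a ≈ b → c ≈ d → a - c ≈ b - d
  minus-cong a≈b c≈d = +-cong a≈b (-‿cong c≈d)

  *-congˡ : ∀ c {a b} → a ≈ b → c * a ≈ c * b
  *-congˡ c {a} {b} (congruence p∣a-b) = congruence (subst (+ p ∣_) (distribˡ-minus c a b) (∣n⇒∣m*n c p∣a-b))
    where
    distribˡ-minus : ∀ c a b → c * (a - b) ≡ c * a - c * b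
    distribˡ-minus = solve-∀

  *-congʳ : ∀ c {a b} → a ≈ b → a * c ≈ b * c
  *-congʳ c {a} {b} a≈b = subst₂ _≈_ (ℤ.*-comm c a) (ℤ.*-comm c b) (*-congˡ c a≈b)

  multiple≈0 : ∀ k → k * + p ≈ 0ℤ
  multiple≈0 k = congruence (divides k (ℤ.+-identityʳ (k * + p)))

  nat-multiple≈0 : ∀ k → + (k ℕ.* p) ≈ 0ℤ
  nat-multiple≈0 k = subst (_≈ 0ℤ) (sym (ℤ.pos-* k p)) (multiple≈0 (+ k))

  p≈0 : + p ≈ 0ℤ
  p≈0 = subst (_≈ 0ℤ) (ℤ.*-identityˡ (+ p)) (multiple≈0 1ℤ)

  join-≈ : ∀ {a b X Y} → + a ≈ X → + b ≈ Y → + (a ℕ.+ b) ≈ X + Y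
  join-≈ {a} {b} a≈X b≈Y = ≈-trans (≈-reflexive (ℤ.pos-+ a b)) (+-cong a≈X b≈Y)

  split-≈ : ∀ {a b X Y} → + (a ℕ.+ b) ≈ X → + a ≈ Y → + b ≈ X - Y
  split-≈ {a} {b} a+b≈X a≈Y = ≈-trans (≈-reflexive (trans (cancel (+ a) (+ b)) (cong (_- + a) (sym (ℤ.pos-+ a b)))))
                                      (minus-cong a+b≈X a≈Y)
    where
    cancel : ∀ a b → b ≡ (a + b) - a
    cancel = solve-∀

  +p≈ : ∀ n → + (p ℕ.+ n) ≈ + n
  +p≈ n = ≈-trans (join-≈ p≈0 (≈-refl {+ n})) (≈-reflexive (ℤ.+-identityˡ (+ n)))

  cancelʳ-≈ : ∀ {x y z w} → x ℕ.+ y ≡ z ℕ.+ w → + y ≈ + w → + x ≈ + z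
  cancelʳ-≈ {x} {y} {z} {w} x+y≡z+w y≈w =
    ≈-trans (split-≈ {y} (≈-reflexive (trans (cong +_ (trans (ℕ.+-comm y x) x+y≡z+w)) (ℤ.pos-+ z w))) y≈w)
            (≈-reflexive (cancel (+ z) (+ w)))
    where
    cancel : ∀ a b → (a + b) - b ≡ a
    cancel = solve-∀

  congruent-separated : ∀ {a b} → + a ≈ + b → a < b → a ℕ.+ p ≤ b
  congruent-separated {a} {b} (congruence p∣a-b) a<b =
    ℕ.≤-trans (ℕ.+-monoʳ-≤ a p≤b∸a) (ℕ.≤-reflexive (ℕ.m+[n∸m]≡n (ℕ.<⇒≤ a<b)))
    where
    p∣b∸a : p ℕ.∣ b ∸ a
    p∣b∸a = subst (p ℕ.∣_) (trans (cong ∣_∣ (ℤ.[+m]-[+n]≡m⊖n a b)) (ℤ.∣⊖∣-< a<b)) (∣⇒∣ᵤ p∣a-b)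
    p≤b∸a : p ≤ b ∸ a
    p≤b∸a = ℕ.∣⇒≤ ⦃ ℕ.>-nonZero (ℕ.m<n⇒0<n∸m a<b) ⦄ p∣b∸a

  congruent-<p⇒≡ : ∀ {a b} → + a ≈ + b → a < p → b < p → a ≡ b
  congruent-<p⇒≡ {a} {b} a≈b a<p b<p with ℕ.<-cmp a b
  ... | tri< a<b _ _ = ⊥-elim (ℕ.<⇒≱ b<p (ℕ.≤-trans (ℕ.m≤n+m p a) (congruent-separated a≈b a<b)))
  ... | tri≈ _ a≡b _ = a≡b
  ... | tri> _ _ b<a = ⊥-elim (ℕ.<⇒≱ a<p (ℕ.≤-trans (ℕ.m≤n+m p b) (congruent-separated (≈-sym a≈b) b<a)))

module LeastResidue (p q : ℕ) ⦃ _ : ℕ.NonZero p ⦄ where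
  open import Data.Integer.Base using (_+_; _*_; -_; _-_)
  open Casts
  open Modular p

  module _ (e : ℤ) {σ S R A : ℕ} (det : σ ℕ.* R ℕ.+ S ℕ.* A ≡ p)
           (A≈eσq : + A ≈ e * (+ σ * + q)) (R≈-eSq : + R ≈ - e * (+ S * + q)) {δ ρ : ℕ}
           (ρ≈eδq : + ρ ≈ e * (+ δ * + q)) where

    private
      lattice-relations : + (δ ℕ.* R ℕ.+ ρ ℕ.* S) ≈ 0ℤ × + δ * + A - + ρ * + σ ≈ 0ℤ
      lattice-relations = (begin
        + (δ ℕ.* R ℕ.+ ρ ℕ.* S)                          ≡⟨ pos-*-+-* δ R ρ S ⟩
        + δ * + R + + ρ * + S                            ≈⟨ +-cong (*-congˡ (+ δ) R≈-eSq) (*-congʳ (+ S) ρ≈eδq) ⟩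
        + δ * (- e * (+ S * + q)) + e * (+ δ * + q) * + S ≡⟨ cancel₁ e (+ δ) (+ S) (+ q) ⟩
        0ℤ                                               ∎) , (begin
        + δ * + A - + ρ * + σ                            ≈⟨ minus-cong (*-congˡ (+ δ) A≈eσq) (*-congʳ (+ σ) ρ≈eδq) ⟩
        + δ * (e * (+ σ * + q)) - e * (+ δ * + q) * + σ  ≡⟨ cancel₂ e (+ δ) (+ σ) (+ q) ⟩
        0ℤ                                               ∎)
        where
        open import Relation.Binary.Reasoning.Setoid ≈-setoid
        cancel₁ : ∀ e δ S q → δ * (- e * (S * q)) + e * (δ * q) * S ≡ 0ℤ
        cancel₁ = solve-∀
        cancel₂ : ∀ e δ σ q → δ * (e * (σ * q)) - e * (δ * q) * σ ≡ 0ℤ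
        cancel₂ = solve-∀

    -- (δ, ρ) ↦ (δ R + ρ S, δ A - ρ σ) sends (δ, ρ) into p ℤ², and inverting this map, whose
    -- determinant is p, expresses (δ, ρ) in the basis (σ, A), (S, -R).
    lattice-coordinates : 1 ≤ δ → 1 ≤ R →
                          ∃[ α ] ∃[ γ ] (1 ≤ α × + δ ≡ + σ * + α + + S * γ × + ρ ≡ + A * + α - + R * γ)
    lattice-coordinates 1≤δ 1≤R = α , γ , 1≤α , δ≡σα+Sγ , ρ≡Aα-Rγ
      where
      X : ℕ
      X = δ ℕ.* R ℕ.+ ρ ℕ.* S
      Y : ℤ
      Y = + δ * + A - + ρ * + σ

      p∣X : p ℕ.∣ X
      p∣X = subst (p ℕ.∣_) (cong ∣_∣ (ℤ.+-identityʳ (+ X)))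
                  (∣⇒∣ᵤ (_≈_.divides-difference (proj₁ lattice-relations)))
      α : ℕ
      α = ℕ.quotient p∣X
      X≡αp : + X ≡ + α * + p
      X≡αp = trans (cong +_ (ℕ._∣_.equality p∣X)) (ℤ.pos-* α p)
      1≤α : 1 ≤ α
      1≤α = ℕ.n≢0⇒n>0 (λ α≡0 → ℕ.<⇒≢ (ℕ.≤-trans (ℕ.*-mono-≤ 1≤δ 1≤R) (ℕ.m≤m+n (δ ℕ.* R) (ρ ℕ.* S)))
                                        (sym (trans (ℕ._∣_.equality p∣X) (cong (ℕ._* p) α≡0))))

      γ : ℤ
      γ = Signed.quotient (_≈_.divides-difference (proj₂ lattice-relations))
      Y≡γp : Y ≡ γ * + p
      Y≡γp = trans (sym (ℤ.+-identityʳ Y)) (Signed._∣_.equality (_≈_.divides-difference (proj₂ lattice-relations)))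

      X′≡αp : + δ * + R + + ρ * + S ≡ + α * + p
      X′≡αp = trans (sym (pos-*-+-* δ R ρ S)) X≡αp

      det′ : + σ * + R + + S * + A ≡ + p
      det′ = trans (sym (pos-*-+-* σ R S A)) (cong +_ det)

      δ≡σα+Sγ : + δ ≡ + σ * + α + + S * γ
      δ≡σα+Sγ = ℤ.*-cancelʳ-≡ (+ δ) _ (+ p) (begin
        + δ * + p                               ≡⟨ cong (+ δ *_) det′ ⟨
        + δ * (+ σ * + R + + S * + A)           ≡⟨ expand (+ δ) (+ ρ) (+ σ) (+ S) (+ R) (+ A) ⟩
        + σ * (+ δ * + R + + ρ * + S) + + S * Y ≡⟨ cong₂ (λ x y → + σ * x + + S * y) X′≡αp Y≡γp ⟩
        + σ * (+ α * + p) + + S * (γ * + p)     ≡⟨ collect (+ σ) (+ α) (+ S) γ (+ p) ⟩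
        (+ σ * + α + + S * γ) * + p             ∎)
        where
        open ≡-Reasoning
        expand : ∀ δ ρ σ S R A → δ * (σ * R + S * A) ≡ σ * (δ * R + ρ * S) + S * (δ * A - ρ * σ)
        expand = solve-∀
        collect : ∀ σ α S γ p → σ * (α * p) + S * (γ * p) ≡ (σ * α + S * γ) * p
        collect = solve-∀

      ρ≡Aα-Rγ : + ρ ≡ + A * + α - + R * γ
      ρ≡Aα-Rγ = ℤ.*-cancelʳ-≡ (+ ρ) _ (+ p) (begin
        + ρ * + p                               ≡⟨ cong (+ ρ *_) det′ ⟨
        + ρ * (+ σ * + R + + S * + A)           ≡⟨ expand (+ δ) (+ ρ) (+ σ) (+ S) (+ R) (+ A) ⟩
        + A * (+ δ * + R + + ρ * + S) - + R * Y ≡⟨ cong₂ (λ x y → + A * x - + R * y) X′≡αp Y≡γp ⟩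
        + A * (+ α * + p) - + R * (γ * + p)     ≡⟨ collect (+ A) (+ α) (+ R) γ (+ p) ⟩
        (+ A * + α - + R * γ) * + p             ∎)
        where
        open ≡-Reasoning
        expand : ∀ δ ρ σ S R A → ρ * (σ * R + S * A) ≡ A * (δ * R + ρ * S) - R * (δ * A - ρ * σ)
        expand = solve-∀
        collect : ∀ A α R γ p → A * (α * p) - R * (γ * p) ≡ (A * α - R * γ) * p
        collect = solve-∀

    -- A coordinate γ > 0 would force δ ≥ σ + S, while γ ≤ 0 gives ρ ≥ A α ≥ A.
    least-residue : 1 ≤ δ → 1 ≤ R → δ < σ ℕ.+ S → A ≤ ρ
    least-residue 1≤δ 1≤R δ<σ+S = from-coordinates (lattice-coordinates 1≤δ 1≤R)
      where
      A≤ρ : ∀ {α} → 1 ≤ α → ∀ g → + ρ ≡ + A * + α - + R * - + g → A ≤ ρ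
      A≤ρ {α} 1≤α g ρ≡ = begin
        A                    ≤⟨ ℕ.m≤m*n A α ⦃ ℕ.>-nonZero 1≤α ⦄ ⟩
        A ℕ.* α              ≤⟨ ℕ.m≤m+n (A ℕ.* α) (R ℕ.* g) ⟩
        A ℕ.* α ℕ.+ R ℕ.* g  ≡⟨ ℤ.+-injective (trans (pos-*-+-* A α R g) (sym (trans ρ≡ (negate (+ A) (+ α) (+ R) (+ g))))) ⟩
        ρ                    ∎
        where
        open ℕ.≤-Reasoning
        negate : ∀ A α R g → A * α - R * - g ≡ A * α + R * g
        negate = solve-∀

      by-sign : ∀ {α} → 1 ≤ α → ∀ γ → + δ ≡ + σ * + α + + S * γ → + ρ ≡ + A * + α - + R * γ → A ≤ ρ
      by-sign 1≤α (+ zero)    _  ρ≡ = A≤ρ 1≤α 0 ρ≡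
      by-sign 1≤α -[1+ g ]    _  ρ≡ = A≤ρ 1≤α (suc g) ρ≡
      by-sign {α} 1≤α (+ (suc g)) δ≡ _ = ⊥-elim (ℕ.<⇒≱ δ<σ+S (begin
        σ ℕ.+ S                 ≤⟨ ℕ.+-mono-≤ (ℕ.m≤m*n σ α ⦃ ℕ.>-nonZero 1≤α ⦄) (ℕ.m≤m*n S (suc g)) ⟩
        σ ℕ.* α ℕ.+ S ℕ.* suc g ≡⟨ ℤ.+-injective (trans (pos-*-+-* σ α S (suc g)) (sym δ≡)) ⟩
        δ                       ∎))
        where open ℕ.≤-Reasoning

      from-coordinates : ∃[ α ] ∃[ γ ] (1 ≤ α × + δ ≡ + σ * + α + + S * γ × + ρ ≡ + A * + α - + R * γ) → A ≤ ρ
      from-coordinates (α , γ , 1≤α , δ≡ , ρ≡) = by-sign 1≤α γ δ≡ ρ≡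

module Indicator where
  open import Data.Integer.Base using (_+_; _-_)

  𝟙[_] : ∀ {A : Set} → Dec A → ℤ
  𝟙[ a? ] = if does a? then 1ℤ else 0ℤ

  𝟙-yes : ∀ {A : Set} (a? : Dec A) → A → 𝟙[ a? ] ≡ 1ℤ
  𝟙-yes a? a = cong (if_then 1ℤ else 0ℤ) (dec-true a? a)

  𝟙-no : ∀ {A : Set} (a? : Dec A) → ¬ A → 𝟙[ a? ] ≡ 0ℤ
  𝟙-no a? ¬a = cong (if_then 1ℤ else 0ℤ) (dec-false a? ¬a)

  𝟙-cong : ∀ {A B : Set} → A ⇔ B → (a? : Dec A) (b? : Dec B) → 𝟙[ a? ] ≡ 𝟙[ b? ]
  𝟙-cong A⇔B (yes a) b? = sym (𝟙-yes b? (Equivalence.to A⇔B a))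
  𝟙-cong A⇔B (no ¬a) b? = sym (𝟙-no b? (¬a ∘ Equivalence.from A⇔B))

  𝟙-⊎ : ∀ {A B C : Set} → A ⇔ (B ⊎ C) → ¬ (B × C) → (a? : Dec A) (b? : Dec B) (c? : Dec C) →
        𝟙[ a? ] ≡ 𝟙[ b? ] + 𝟙[ c? ]
  𝟙-⊎ A⇔B⊎C disjoint (yes a) (yes b) (yes c) = ⊥-elim (disjoint (b , c))
  𝟙-⊎ A⇔B⊎C disjoint (yes a) (yes b) (no ¬c) = refl
  𝟙-⊎ A⇔B⊎C disjoint (yes a) (no ¬b) (yes c) = refl
  𝟙-⊎ A⇔B⊎C disjoint (yes a) (no ¬b) (no ¬c) = ⊥-elim ([ ¬b , ¬c ] (Equivalence.to A⇔B⊎C a))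
  𝟙-⊎ A⇔B⊎C disjoint (no ¬a) (yes b) c?      = ⊥-elim (¬a (Equivalence.from A⇔B⊎C (inj₁ b)))
  𝟙-⊎ A⇔B⊎C disjoint (no ¬a) (no ¬b) (yes c) = ⊥-elim (¬a (Equivalence.from A⇔B⊎C (inj₂ c)))
  𝟙-⊎ A⇔B⊎C disjoint (no ¬a) (no ¬b) (no ¬c) = refl

  𝟙-difference≡0 : ∀ {A B : Set} (a? : Dec A) (b? : Dec B) → 𝟙[ a? ] - 𝟙[ b? ] ≡ 0ℤ → A ⇔ B
  𝟙-difference≡0 (yes a) (yes b) _  = mk⇔ (λ _ → b) (λ _ → a)
  𝟙-difference≡0 (yes a) (no ¬b) ()
  𝟙-difference≡0 (no ¬a) (yes b) ()
  𝟙-difference≡0 (no ¬a) (no ¬b) _  = mk⇔ (⊥-elim ∘ ¬a) (⊥-elim ∘ ¬b)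

  𝟙-difference≢0 : ∀ {A B : Set} (a? : Dec A) (b? : Dec B) → 𝟙[ a? ] - 𝟙[ b? ] ≢ 0ℤ ⇔ (A ⇔ (¬ B))
  𝟙-difference≢0 (yes a) (yes b) =
    mk⇔ (λ ≢0 → ⊥-elim (≢0 refl)) (λ A⇔¬B → ⊥-elim (Equivalence.to A⇔¬B a b))
  𝟙-difference≢0 (yes a) (no ¬b) = mk⇔ (λ _ → mk⇔ (λ _ → ¬b) (λ _ → a)) (λ _ ())
  𝟙-difference≢0 (no ¬a) (yes b) = mk⇔ (λ _ → mk⇔ (⊥-elim ∘ ¬a) (λ ¬b → ⊥-elim (¬b b))) (λ _ ())
  𝟙-difference≢0 (no ¬a) (no ¬b) =
    mk⇔ (λ ≢0 → ⊥-elim (≢0 refl)) (λ A⇔¬B → ⊥-elim (¬a (Equivalence.from A⇔¬B ¬b)))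

module Convolution where
  open import Data.Integer.Base using (_+_; _*_; -_; _-_)
  open import Algebra.Properties.AbelianGroup ℤ.+-0-abelianGroup using (∙-cancelˡ)
  open Indicator

  extend : Poly → ℤ → ℤ
  extend g (+ n)    = g n
  extend g -[1+ n ] = 0ℤ

  extend-≥ : ∀ g {n k} → k ≤ n → extend g (+ n - + k) ≡ g (n ∸ k)
  extend-≥ g {n} {k} k≤n = cong (extend g) (trans (ℤ.[+m]-[+n]≡m⊖n n k) (ℤ.⊖-≥ k≤n))

  extend-< : ∀ g {n k} → n < k → extend g (+ n - + k) ≡ 0ℤ
  extend-< g {n} {k} n<k =
    trans (cong (extend g) (trans (ℤ.[+m]-[+n]≡m⊖n n k) (ℤ.⊖-< n<k))) (extend-neg (k ∸ n) (ℕ.m<n⇒0<n∸m n<k))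
    where
    extend-neg : ∀ d → 0 < d → extend g (- + d) ≡ 0ℤ
    extend-neg (suc d) _ = refl

  Δ : ℕ → (ℤ → ℤ) → ℤ → ℤ
  Δ a F k = F k - F (k - + a)

  Δ-cong : ∀ a {F G} → (∀ k → F k ≡ G k) → ∀ k → Δ a F k ≡ Δ a G k
  Δ-cong a F≗G k = cong₂ _-_ (F≗G k) (F≗G (k - + a))

  Δ-comm : ∀ a b F k → Δ a (Δ b F) k ≡ Δ b (Δ a F) k
  Δ-comm a b F k = trans (cong (λ j → (F k - F (k - + b)) - (F (k - + a) - F j)) (shifts-commute k (+ a) (+ b)))
                         (rearrange (F k) (F (k - + b)) (F (k - + a)) (F (k - + b - + a)))
    where
    shifts-commute : ∀ k a b → k - a - b ≡ k - b - a
    shifts-commute = solve-∀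
    rearrange : ∀ x y z w → (x - y) - (z - w) ≡ (x - z) - (y - w)
    rearrange = solve-∀

  Δ-extend : ∀ a g {h} → (∀ n → Δ a (extend g) (+ n) ≡ h n) → ∀ k → Δ a (extend g) k ≡ extend h k
  Δ-extend a g Δg≗h (+ n)    = Δg≗h n
  Δ-extend a g Δg≗h -[1+ n ] = cong (λ x → 0ℤ - x) (shifted-negative a)
    where
    shifted-negative : ∀ a → extend g (-[1+ n ] - + a) ≡ 0ℤ
    shifted-negative zero    = refl
    shifted-negative (suc a) = refl

  Σ≤-cong : ∀ n {g h} → (∀ i → i ≤ n → g i ≡ h i) → Σ≤ n g ≡ Σ≤ n h
  Σ≤-cong zero    g≗h = g≗h 0 z≤n
  Σ≤-cong (suc n) g≗h = cong₂ _+_ (Σ≤-cong n (λ i i≤n → g≗h i (ℕ.m≤n⇒m≤1+n i≤n))) (g≗h (suc n) ℕ.≤-refl)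

  Σ≤-distrib-+ : ∀ n g h → Σ≤ n (λ i → g i + h i) ≡ Σ≤ n g + Σ≤ n h
  Σ≤-distrib-+ zero    g h = refl
  Σ≤-distrib-+ (suc n) g h = trans (cong (_+ (g (suc n) + h (suc n))) (Σ≤-distrib-+ n g h))
                                   (interchange (Σ≤ n g) (Σ≤ n h) (g (suc n)) (h (suc n)))
    where
    interchange : ∀ a b c d → (a + b) + (c + d) ≡ (a + c) + (b + d)
    interchange = solve-∀

  Σ≤-neg : ∀ n g → Σ≤ n (λ i → - g i) ≡ - Σ≤ n g
  Σ≤-neg zero    g = refl
  Σ≤-neg (suc n) g = trans (cong (_+ (- g (suc n))) (Σ≤-neg n g)) (sym (ℤ.neg-distrib-+ (Σ≤ n g) (g (suc n))))

  Σ≤-zero : ∀ n g → (∀ i → i ≤ n → g i ≡ 0ℤ) → Σ≤ n g ≡ 0ℤ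
  Σ≤-zero zero    g g≗0 = g≗0 0 z≤n
  Σ≤-zero (suc n) g g≗0 =
    cong₂ _+_ (Σ≤-zero n g (λ i i≤n → g≗0 i (ℕ.m≤n⇒m≤1+n i≤n))) (g≗0 (suc n) ℕ.≤-refl)

  Σ≤-single : ∀ n g {i₀} → i₀ ≤ n → (∀ i → i ≤ n → i ≢ i₀ → g i ≡ 0ℤ) → Σ≤ n g ≡ g i₀
  Σ≤-single zero    g z≤n _ = refl
  Σ≤-single (suc n) g {i₀} i₀≤1+n others with i₀ ℕ.≟ suc n
  ... | yes refl = trans (cong (_+ g (suc n)) (Σ≤-zero n g below)) (ℤ.+-identityˡ _)
    where
    below : ∀ i → i ≤ n → g i ≡ 0ℤ
    below i i≤n = others i (ℕ.m≤n⇒m≤1+n i≤n) (ℕ.<⇒≢ (s≤s i≤n))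
  ... | no i₀≢1+n = trans (cong₂ _+_ (Σ≤-single n g i₀≤n (λ i i≤n → others i (ℕ.m≤n⇒m≤1+n i≤n)))
                                     (others (suc n) ℕ.≤-refl (i₀≢1+n ∘ sym)))
                          (ℤ.+-identityʳ _)
    where
    i₀≤n : i₀ ≤ n
    i₀≤n = ℕ.≤-pred (ℕ.≤∧≢⇒< i₀≤1+n i₀≢1+n)

  X^-diag : ∀ k → X^ k k ≡ 1ℤ
  X^-diag k = 𝟙-yes (k ℕ.≟ k) refl

  X^-offdiag : ∀ {m k} → m ≢ k → X^ k m ≡ 0ℤ
  X^-offdiag {m} {k} = 𝟙-no (m ℕ.≟ k)

  extend-X^ : ∀ j b m → extend (X^ j) (+ m - + b) ≡ X^ (j ℕ.+ b) m
  extend-X^ j b m with b ℕ.≤? m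
  ... | yes b≤m = trans (extend-≥ (X^ j) b≤m) (𝟙-cong m∸b≡j⇔m≡j+b (m ∸ b ℕ.≟ j) (m ℕ.≟ j ℕ.+ b))
    where
    m∸b≡j⇔m≡j+b : m ∸ b ≡ j ⇔ m ≡ j ℕ.+ b
    m∸b≡j⇔m≡j+b = mk⇔ (λ m∸b≡j → trans (sym (ℕ.m∸n+n≡m b≤m)) (cong (ℕ._+ b) m∸b≡j))
                      (λ m≡j+b → trans (cong (_∸ b) m≡j+b) (ℕ.m+n∸n≡m j b))
  ... | no b≰m = trans (extend-< (X^ j) (ℕ.≰⇒> b≰m)) (sym (X^-offdiag m≢j+b))
    where
    m≢j+b : m ≢ j ℕ.+ b
    m≢j+b m≡j+b = b≰m (subst (b ≤_) (sym m≡j+b) (ℕ.m≤n+m b j))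

  ⊛-congʳ : ∀ g {a b} → (∀ m → a m ≡ b m) → ∀ n → (g ⊛ a) n ≡ (g ⊛ b) n
  ⊛-congʳ g a≗b n = Σ≤-cong n (λ i _ → cong (g i *_) (a≗b (n ∸ i)))

  ⊛-distribˡ-+ : ∀ g a b n → (g ⊛ (λ m → a m + b m)) n ≡ (g ⊛ a) n + (g ⊛ b) n
  ⊛-distribˡ-+ g a b n = trans (Σ≤-cong n (λ i _ → ℤ.*-distribˡ-+ (g i) (a (n ∸ i)) (b (n ∸ i)))) (Σ≤-distrib-+ n _ _)

  ⊛-distribˡ-minus : ∀ g a b n → (g ⊛ (λ m → a m - b m)) n ≡ (g ⊛ a) n - (g ⊛ b) n
  ⊛-distribˡ-minus g a b n =
    trans (⊛-distribˡ-+ g a (λ m → - b m) n)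
          (cong (λ x → (g ⊛ a) n + x)
                (trans (Σ≤-cong n (λ i _ → sym (ℤ.neg-distribʳ-* (g i) (b (n ∸ i))))) (Σ≤-neg n _)))

  ⊛-X^ : ∀ g k n → (g ⊛ X^ k) n ≡ extend g (+ n - + k)
  ⊛-X^ g k n with k ℕ.≤? n
  ... | yes k≤n = begin
      Σ≤ n (λ i → g i * X^ k (n ∸ i)) ≡⟨ Σ≤-single n _ (ℕ.m∸n≤m n k) off-diagonal ⟩
      g (n ∸ k) * X^ k (n ∸ (n ∸ k))  ≡⟨ cong (λ j → g (n ∸ k) * X^ k j) (ℕ.m∸[m∸n]≡n k≤n) ⟩
      g (n ∸ k) * X^ k k              ≡⟨ cong (g (n ∸ k) *_) (X^-diag k) ⟩
      g (n ∸ k) * 1ℤ                  ≡⟨ ℤ.*-identityʳ _ ⟩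
      g (n ∸ k)                       ≡⟨ extend-≥ g k≤n ⟨
      extend g (+ n - + k)            ∎
    where
    open ≡-Reasoning
    off-diagonal : ∀ i → i ≤ n → i ≢ n ∸ k → g i * X^ k (n ∸ i) ≡ 0ℤ
    off-diagonal i i≤n i≢n∸k = trans (cong (g i *_) (X^-offdiag {n ∸ i} {k} (λ n∸i≡k → i≢n∸k
      (trans (sym (ℕ.m∸[m∸n]≡n i≤n)) (cong (n ∸_) n∸i≡k))))) (ℤ.*-zeroʳ (g i))
  ... | no k≰n = trans (Σ≤-zero n _ vanishing) (sym (extend-< g (ℕ.≰⇒> k≰n)))
    where
    vanishing : ∀ i → i ≤ n → g i * X^ k (n ∸ i) ≡ 0ℤ
    vanishing i _ = trans (cong (g i *_) (X^-offdiag {n ∸ i} {k} (λ n∸i≡k → k≰n (subst (_≤ n) n∸i≡k (ℕ.m∸n≤m n i)))))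
                          (ℤ.*-zeroʳ (g i))

  ⊛-1-X^ : ∀ g k n → (g ⊛ 1-X^ k) n ≡ Δ k (extend g) (+ n)
  ⊛-1-X^ g k n = trans (⊛-distribˡ-minus g (X^ 0) (X^ k) n)
                       (cong₂ _-_ (trans (⊛-X^ g 0 n) (cong (extend g) (ℤ.+-identityʳ (+ n)))) (⊛-X^ g k n))

  Den-coeff : ∀ a b m → Den a b m ≡ 1-X^ a m - (X^ b m - X^ (a ℕ.+ b) m)
  Den-coeff a b m = trans (⊛-1-X^ (1-X^ a) b m) (cong (λ x → 1-X^ a m - x) shifted)
    where
    extend-1-X^ : ∀ k → extend (1-X^ a) k ≡ extend (X^ 0) k - extend (X^ a) k
    extend-1-X^ (+ n)    = refl
    extend-1-X^ -[1+ n ] = refl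
    shifted : extend (1-X^ a) (+ m - + b) ≡ X^ b m - X^ (a ℕ.+ b) m
    shifted = trans (extend-1-X^ (+ m - + b)) (cong₂ _-_ (extend-X^ 0 b m) (extend-X^ a b m))

  ⊛-Den : ∀ g a b n → (g ⊛ Den a b) n ≡ Δ b (Δ a (extend g)) (+ n)
  ⊛-Den g a b n = begin
    (g ⊛ Den a b) n
      ≡⟨ ⊛-congʳ g (Den-coeff a b) n ⟩
    (g ⊛ (λ m → 1-X^ a m - (X^ b m - X^ (a ℕ.+ b) m))) n
      ≡⟨ ⊛-distribˡ-minus g (1-X^ a) (λ m → X^ b m - X^ (a ℕ.+ b) m) n ⟩
    (g ⊛ 1-X^ a) n - (g ⊛ (λ m → X^ b m - X^ (a ℕ.+ b) m)) n
      ≡⟨ cong₂ _-_ (⊛-1-X^ g a n) (⊛-distribˡ-minus g (X^ b) (X^ (a ℕ.+ b)) n) ⟩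
    Δ a G (+ n) - ((g ⊛ X^ b) n - (g ⊛ X^ (a ℕ.+ b)) n)
      ≡⟨ cong (λ x → Δ a G (+ n) - x) (cong₂ _-_ (⊛-X^ g b n) (trans (⊛-X^ g (a ℕ.+ b) n) (cong G shift-sum))) ⟩
    Δ a G (+ n) - Δ a G (+ n - + b)
      ∎
    where
    open ≡-Reasoning
    G : ℤ → ℤ
    G = extend g
    shift-sum : + n - + (a ℕ.+ b) ≡ + n - + b - + a
    shift-sum = trans (cong (λ x → + n - x) (ℤ.pos-+ a b)) (reassociate (+ n) (+ a) (+ b))
      where
      reassociate : ∀ x a b → x - (a + b) ≡ x - b - a
      reassociate = solve-∀

  Den-0 : ∀ {a b} → 1 ≤ a → 1 ≤ b → Den a b 0 ≡ 1ℤ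
  Den-0 (s≤s _) (s≤s _) = refl

  ⊛-cancelʳ : ∀ {f h D} → D 0 ≡ 1ℤ → (∀ n → (f ⊛ D) n ≡ (h ⊛ D) n) → ∀ n → f n ≡ h n
  ⊛-cancelʳ {f} {h} {D} D0≡1 f⊛D≗h⊛D n = agree n n ℕ.≤-refl
    where
    lower : Poly → ℕ → ℤ
    lower g n = Σ≤ n (λ i → g i * D (suc n ∸ i))
    split : ∀ g n → (g ⊛ D) (suc n) ≡ lower g n + g (suc n)
    split g n = cong (λ x → lower g n + x)
      (trans (cong (λ j → g (suc n) * D j) (ℕ.n∸n≡0 n)) (trans (cong (g (suc n) *_) D0≡1) (ℤ.*-identityʳ _)))
    constant : ∀ g → (g ⊛ D) 0 ≡ g 0
    constant g = trans (cong (g 0 *_) D0≡1) (ℤ.*-identityʳ _)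
    agree : ∀ n i → i ≤ n → f i ≡ h i
    agree zero    .zero z≤n = trans (sym (constant f)) (trans (f⊛D≗h⊛D 0) (constant h))
    agree (suc n) i i≤1+n with ℕ.m≤n⇒m<n∨m≡n i≤1+n
    ... | inj₁ i<1+n = agree n i (ℕ.≤-pred i<1+n)
    ... | inj₂ refl  = ∙-cancelˡ (lower f n) (f (suc n)) (h (suc n)) (begin
      lower f n + f (suc n) ≡⟨ split f n ⟨
      (f ⊛ D) (suc n)       ≡⟨ f⊛D≗h⊛D (suc n) ⟩
      (h ⊛ D) (suc n)       ≡⟨ split h n ⟩
      lower h n + h (suc n) ≡⟨ cong (_+ h (suc n)) (Σ≤-cong n (λ j j≤n → cong (_* D (suc n ∸ j)) (agree n j j≤n))) ⟨
      lower f n + h (suc n) ∎)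
      where open ≡-Reasoning

module NumericalSemigroup (p q : ℕ) (1<p : 1 < p) (p≤q : p ≤ q) (p⊥q : Coprime p q) where
  open import Data.Integer.Base using (_+_; _*_; -_; _-_)
  open import Data.Integer.DivMod using (_%ℕ_; _/ℕ_; n%ℕd<d; a≡a%ℕn+[a/ℕn]*n)
  open Casts
  open Modular p
  open Indicator
  open Convolution

  0<p : 0 < p
  0<p = ℕ.<-trans (s≤s z≤n) 1<p

  instance
    p-nonZero : ℕ.NonZero p
    p-nonZero = ℕ.>-nonZero 0<p

  1≤q : 1 ≤ q
  1≤q = ℕ.≤-trans (ℕ.<⇒≤ 1<p) p≤q

  pred[p]<p : ℕ.pred p < p
  pred[p]<p = subst (ℕ.pred p <_) (ℕ.suc-pred p) ℕ.≤-refl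

  private
    q-invertible : ∃[ u ] (+ q * u ≈ 1ℤ)
    q-invertible with coprime-Bézout p⊥q
    ... | Bézout.+- x y 1+yq≡xp = - + y , (begin
      + q * - + y          ≡⟨ rearrange (+ q) (+ y) ⟩
      1ℤ - (1ℤ + + y * + q) ≡⟨ cong (λ n → 1ℤ - n) (trans (sym (pos-+-* 1 y q)) (cong +_ 1+yq≡xp)) ⟩
      1ℤ - + (x ℕ.* p)     ≈⟨ minus-cong (≈-refl {1ℤ}) (nat-multiple≈0 x) ⟩
      1ℤ - 0ℤ              ≡⟨⟩
      1ℤ                   ∎)
      where
      open import Relation.Binary.Reasoning.Setoid ≈-setoid
      rearrange : ∀ q y → q * - y ≡ 1ℤ - (1ℤ + y * q)
      rearrange = solve-∀
    ... | Bézout.-+ x y 1+xp≡yq = + y , (begin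
      + q * + y          ≡⟨ trans (ℤ.*-comm (+ q) (+ y)) (sym (ℤ.pos-* y q)) ⟩
      + (y ℕ.* q)        ≡⟨ cong +_ 1+xp≡yq ⟨
      + (1 ℕ.+ x ℕ.* p)  ≡⟨ ℤ.pos-+ 1 (x ℕ.* p) ⟩
      1ℤ + + (x ℕ.* p)   ≈⟨ +-cong (≈-refl {1ℤ}) (nat-multiple≈0 x) ⟩
      1ℤ + 0ℤ            ≡⟨⟩
      1ℤ                 ∎)
      where open import Relation.Binary.Reasoning.Setoid ≈-setoid

    q⁻¹ : ℤ
    q⁻¹ = proj₁ q-invertible

  -- qCoeff n is the j < p with n ≡ j q (mod p).
  qCoeff : ℕ → ℕ
  qCoeff n = (+ n * q⁻¹) %ℕ p

  qCoeff<p : ∀ n → qCoeff n < p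
  qCoeff<p n = n%ℕd<d (+ n * q⁻¹) p

  private
    qCoeff≈ : ∀ n → + qCoeff n ≈ + n * q⁻¹
    qCoeff≈ n = ≈-sym (congruence (divides (x /ℕ p) (begin
      x - + (x %ℕ p)                           ≡⟨ cong (λ y → y - + (x %ℕ p)) (a≡a%ℕn+[a/ℕn]*n x p) ⟩
      + (x %ℕ p) + (x /ℕ p) * + p - + (x %ℕ p) ≡⟨ cancel (+ (x %ℕ p)) ((x /ℕ p) * + p) ⟩
      (x /ℕ p) * + p                           ∎)))
      where
      open ≡-Reasoning
      x : ℤ
      x = + n * q⁻¹
      cancel : ∀ r m → r + m - r ≡ m
      cancel = solve-∀

  qCoeff-correct : ∀ n → + (qCoeff n ℕ.* q) ≈ + n
  qCoeff-correct n = begin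
    + (qCoeff n ℕ.* q)     ≡⟨ ℤ.pos-* (qCoeff n) q ⟩
    + qCoeff n * + q       ≈⟨ *-congʳ (+ q) (qCoeff≈ n) ⟩
    + n * q⁻¹ * + q        ≡⟨ rearrange (+ n) q⁻¹ (+ q) ⟩
    + n * (+ q * q⁻¹)      ≈⟨ *-congˡ (+ n) (proj₂ q-invertible) ⟩
    + n * 1ℤ               ≡⟨ ℤ.*-identityʳ (+ n) ⟩
    + n                    ∎
    where
    open import Relation.Binary.Reasoning.Setoid ≈-setoid
    rearrange : ∀ n u q → n * u * q ≡ n * (q * u)
    rearrange = solve-∀

  qCoeff-unique : ∀ {j n} → j < p → + (j ℕ.* q) ≈ + n → j ≡ qCoeff n
  qCoeff-unique {j} {n} j<p jq≈n = congruent-<p⇒≡ j≈qCoeff j<p (qCoeff<p n)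
    where
    open import Relation.Binary.Reasoning.Setoid ≈-setoid
    rearrange : ∀ j q u → j * (q * u) ≡ j * q * u
    rearrange = solve-∀
    j≈qCoeff : + j ≈ + qCoeff n
    j≈qCoeff = begin
      + j                  ≡⟨ ℤ.*-identityʳ (+ j) ⟨
      + j * 1ℤ             ≈⟨ *-congˡ (+ j) (proj₂ q-invertible) ⟨
      + j * (+ q * q⁻¹)    ≡⟨ rearrange (+ j) (+ q) q⁻¹ ⟩
      + j * + q * q⁻¹      ≡⟨ cong (_* q⁻¹) (ℤ.pos-* j q) ⟨
      + (j ℕ.* q) * q⁻¹    ≈⟨ *-congʳ q⁻¹ jq≈n ⟩
      + n * q⁻¹            ≈⟨ qCoeff≈ n ⟨
      + qCoeff n           ∎

  qCoeff-cong : ∀ {m n} → + m ≈ + n → qCoeff m ≡ qCoeff n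
  qCoeff-cong {m} m≈n = qCoeff-unique (qCoeff<p m) (≈-trans (qCoeff-correct m) m≈n)

  -- n ∈ ⟨p, q⟩ iff n - qCoeff n · q is a nonnegative multiple of p.
  InS : ℕ → Set
  InS n = qCoeff n ℕ.* q ≤ n

  InS? : ∀ n → Dec (InS n)
  InS? n = qCoeff n ℕ.* q ℕ.≤? n

  InS-intro : ∀ {j n} → j < p → + (j ℕ.* q) ≈ + n → j ℕ.* q ≤ n → InS n
  InS-intro {n = n} j<p jq≈n jq≤n = subst (λ j → j ℕ.* q ≤ n) (qCoeff-unique j<p jq≈n) jq≤n

  InS-0 : InS 0
  InS-0 = InS-intro 0<p ≈-refl z≤n

  InS-+p : ∀ {n} → InS n → InS (p ℕ.+ n)
  InS-+p {n} n∈S = subst (λ j → j ℕ.* q ≤ p ℕ.+ n) (qCoeff-cong (≈-sym (+p≈ n))) (ℕ.≤-trans n∈S (ℕ.m≤n+m n p))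

  Apéry : ℕ → Set
  Apéry n = n ≡ qCoeff n ℕ.* q

  Apéry? : ∀ n → Dec (Apéry n)
  Apéry? n = n ℕ.≟ qCoeff n ℕ.* q

  Apéry⇔ : ∀ {n} → Apéry n ⇔ (∃[ j ] (j < p × n ≡ j ℕ.* q))
  Apéry⇔ {n} = mk⇔ (λ n≡jq → qCoeff n , qCoeff<p n , n≡jq)
    (λ (j , j<p , n≡jq) → trans n≡jq (cong (ℕ._* q) (qCoeff-unique j<p (≈-reflexive (cong +_ (sym n≡jq))))))

  InS⇒Apéry : ∀ {n} → InS n → n < qCoeff n ℕ.* q ℕ.+ p → Apéry n
  InS⇒Apéry {n} n∈S n<jq+p with ℕ.m≤n⇒m<n∨m≡n n∈S
  ... | inj₂ jq≡n = sym jq≡n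
  ... | inj₁ jq<n = ⊥-elim (ℕ.<⇒≱ n<jq+p (congruent-separated (qCoeff-correct n) jq<n))

  InS-split : ∀ m → InS (p ℕ.+ m) ⇔ (InS m ⊎ Apéry (p ℕ.+ m))
  InS-split m = mk⇔ to [ InS-+p , ℕ.≤-reflexive ∘ sym ]
    where
    to : InS (p ℕ.+ m) → InS m ⊎ Apéry (p ℕ.+ m)
    to n∈S with InS? m
    ... | yes m∈S = inj₁ m∈S
    ... | no  m∉S = inj₂ (InS⇒Apéry n∈S (subst (λ j → p ℕ.+ m < j ℕ.* q ℕ.+ p) (qCoeff-cong (≈-sym (+p≈ m)))
                            (subst (p ℕ.+ m <_) (ℕ.+-comm p _) (ℕ.+-monoʳ-< p (ℕ.≰⇒> m∉S)))))

  InS-Apéry-disjoint : ∀ m → ¬ (InS m × Apéry (p ℕ.+ m))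
  InS-Apéry-disjoint m (m∈S , p+m≡jq) = ℕ.<⇒≱ (ℕ.m<n+m m 0<p) (begin
    p ℕ.+ m                   ≡⟨ p+m≡jq ⟩
    qCoeff (p ℕ.+ m) ℕ.* q    ≡⟨ cong (ℕ._* q) (qCoeff-cong (+p≈ m)) ⟩
    qCoeff m ℕ.* q            ≤⟨ m∈S ⟩
    m                         ∎)
    where open ℕ.≤-Reasoning

  InS-below-p : ∀ {n} → n < p → InS n ⇔ Apéry n
  InS-below-p {n} n<p = mk⇔ (λ n∈S → InS⇒Apéry n∈S (ℕ.<-≤-trans n<p (ℕ.m≤n+m p _))) (ℕ.≤-reflexive ∘ sym)

  Apéry-split : ∀ m → Apéry m ⇔ (Apéry (q ℕ.+ m) ⊎ q ℕ.+ m ≡ p ℕ.* q)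
  Apéry-split m = mk⇔ to from
    where
    to : Apéry m → Apéry (q ℕ.+ m) ⊎ q ℕ.+ m ≡ p ℕ.* q
    to m∈Ap with Equivalence.to Apéry⇔ m∈Ap
    ... | j , j<p , m≡jq with suc j ℕ.<? p
    ...   | yes 1+j<p = inj₁ (Equivalence.from Apéry⇔ (suc j , 1+j<p , cong (q ℕ.+_) m≡jq))
    ...   | no  1+j≮p = inj₂ (trans (cong (q ℕ.+_) m≡jq) (cong (ℕ._* q) (ℕ.≤-antisym j<p (ℕ.≮⇒≥ 1+j≮p))))
    from : Apéry (q ℕ.+ m) ⊎ q ℕ.+ m ≡ p ℕ.* q → Apéry m
    from (inj₁ q+m∈Ap) with Equivalence.to Apéry⇔ q+m∈Ap
    ... | zero  , _   , q+m≡0 = ⊥-elim (ℕ.<⇒≱ (ℕ.≤-trans 1≤q (ℕ.m≤m+n q m)) (ℕ.≤-reflexive q+m≡0))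
    ... | suc j , j<p , q+m≡q+jq = Equivalence.from Apéry⇔ (j , ℕ.<-trans (ℕ.n<1+n j) j<p , ℕ.+-cancelˡ-≡ q m _ q+m≡q+jq)
    from (inj₂ q+m≡pq) = Equivalence.from Apéry⇔ (ℕ.pred p , pred[p]<p ,
      ℕ.+-cancelˡ-≡ q m _ (trans q+m≡pq (cong (ℕ._* q) (sym (ℕ.suc-pred p)))))

  Apéry-split-disjoint : ∀ m → ¬ (Apéry (q ℕ.+ m) × q ℕ.+ m ≡ p ℕ.* q)
  Apéry-split-disjoint m (q+m∈Ap , q+m≡pq) with Equivalence.to Apéry⇔ q+m∈Ap
  ... | j , j<p , q+m≡jq = ℕ.<-irrefl (ℕ.*-cancelʳ-≡ j p q ⦃ ℕ.>-nonZero 1≤q ⦄ (trans (sym q+m≡jq) q+m≡pq)) j<p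

  Apéry-below-q : ∀ {n} → n < q → Apéry n ⇔ n ≡ 0
  Apéry-below-q {n} n<q = mk⇔ to (λ { refl → Equivalence.from Apéry⇔ (0 , 0<p , refl) })
    where
    to : Apéry n → n ≡ 0
    to n∈Ap with Equivalence.to Apéry⇔ n∈Ap
    ... | zero  , _ , n≡0    = n≡0
    ... | suc j , _ , n≡q+jq = ⊥-elim (ℕ.<⇒≱ n<q (subst (q ≤_) (sym n≡q+jq) (ℕ.m≤m+n q (j ℕ.* q))))

  𝟙S : Poly
  𝟙S n = 𝟙[ InS? n ]

  𝟙Ap : Poly
  𝟙Ap n = 𝟙[ Apéry? n ]

  Δp-𝟙S : ∀ k → Δ p (extend 𝟙S) k ≡ extend 𝟙Ap k
  Δp-𝟙S = Δ-extend p 𝟙S Δp-𝟙S-ℕ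
    where
    Δp-𝟙S-ℕ : ∀ n → Δ p (extend 𝟙S) (+ n) ≡ 𝟙Ap n
    Δp-𝟙S-ℕ n with p ℕ.≤? n
    ... | no p≰n = begin
      𝟙S n - extend 𝟙S (+ n - + p) ≡⟨ cong (λ x → 𝟙S n - x) (extend-< 𝟙S (ℕ.≰⇒> p≰n)) ⟩
      𝟙S n - 0ℤ                    ≡⟨ ℤ.+-identityʳ (𝟙S n) ⟩
      𝟙S n                         ≡⟨ 𝟙-cong (InS-below-p (ℕ.≰⇒> p≰n)) (InS? n) (Apéry? n) ⟩
      𝟙Ap n                        ∎
      where open ≡-Reasoning
    ... | yes p≤n with ℕ.m≤n⇒∃[o]m+o≡n p≤n
    ...   | m , refl = begin
      𝟙S (p ℕ.+ m) - extend 𝟙S (+ (p ℕ.+ m) - + p)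
        ≡⟨ cong (λ x → 𝟙S (p ℕ.+ m) - x) (trans (extend-≥ 𝟙S p≤n) (cong 𝟙S (ℕ.m+n∸m≡n p m))) ⟩
      𝟙S (p ℕ.+ m) - 𝟙S m
        ≡⟨ cong (_- 𝟙S m) (𝟙-⊎ (InS-split m) (InS-Apéry-disjoint m) (InS? (p ℕ.+ m)) (InS? m) (Apéry? (p ℕ.+ m))) ⟩
      𝟙S m + 𝟙Ap (p ℕ.+ m) - 𝟙S m
        ≡⟨ cancel (𝟙S m) (𝟙Ap (p ℕ.+ m)) ⟩
      𝟙Ap (p ℕ.+ m) ∎
      where
      open ≡-Reasoning
      cancel : ∀ a b → a + b - a ≡ b
      cancel = solve-∀

  Δq-𝟙Ap : ∀ k → Δ q (extend 𝟙Ap) k ≡ extend (1-X^ (p ℕ.* q)) k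
  Δq-𝟙Ap = Δ-extend q 𝟙Ap Δq-𝟙Ap-ℕ
    where
    Δq-𝟙Ap-ℕ : ∀ n → Δ q (extend 𝟙Ap) (+ n) ≡ 1-X^ (p ℕ.* q) n
    Δq-𝟙Ap-ℕ n with q ℕ.≤? n
    ... | no q≰n = begin
      𝟙Ap n - extend 𝟙Ap (+ n - + q) ≡⟨ cong (λ x → 𝟙Ap n - x) (extend-< 𝟙Ap (ℕ.≰⇒> q≰n)) ⟩
      𝟙Ap n - 0ℤ                     ≡⟨ cong₂ _-_ (𝟙-cong (Apéry-below-q (ℕ.≰⇒> q≰n)) (Apéry? n) (n ℕ.≟ 0))
                                                  (sym (X^-offdiag n≢pq)) ⟩
      X^ 0 n - X^ (p ℕ.* q) n        ∎
      where
      open ≡-Reasoning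
      n≢pq : n ≢ p ℕ.* q
      n≢pq n≡pq = q≰n (subst (q ≤_) (sym n≡pq) (ℕ.m≤n*m q p ⦃ p-nonZero ⦄))
    ... | yes q≤n with ℕ.m≤n⇒∃[o]m+o≡n q≤n
    ...   | m , refl = begin
      𝟙Ap (q ℕ.+ m) - extend 𝟙Ap (+ (q ℕ.+ m) - + q)
        ≡⟨ cong (λ x → 𝟙Ap (q ℕ.+ m) - x) (trans (extend-≥ 𝟙Ap q≤n) (cong 𝟙Ap (ℕ.m+n∸m≡n q m))) ⟩
      𝟙Ap (q ℕ.+ m) - 𝟙Ap m
        ≡⟨ cong (λ x → 𝟙Ap (q ℕ.+ m) - x)
             (𝟙-⊎ (Apéry-split m) (Apéry-split-disjoint m) (Apéry? m) (Apéry? (q ℕ.+ m)) (q ℕ.+ m ℕ.≟ p ℕ.* q)) ⟩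
      𝟙Ap (q ℕ.+ m) - (𝟙Ap (q ℕ.+ m) + X^ (p ℕ.* q) (q ℕ.+ m))
        ≡⟨ cancel (𝟙Ap (q ℕ.+ m)) (X^ (p ℕ.* q) (q ℕ.+ m)) ⟩
      0ℤ - X^ (p ℕ.* q) (q ℕ.+ m)
        ≡⟨ cong (_- X^ (p ℕ.* q) (q ℕ.+ m)) (sym (X^-offdiag (ℕ.<⇒≢ (ℕ.<-≤-trans 1≤q (ℕ.m≤m+n q m)) ∘ sym))) ⟩
      X^ 0 (q ℕ.+ m) - X^ (p ℕ.* q) (q ℕ.+ m) ∎
      where
      open ≡-Reasoning
      cancel : ∀ a b → a - (a + b) ≡ 0ℤ - b
      cancel = solve-∀

  Q-coeff : ∀ f → IsQ p q f → ∀ n → f n ≡ Δ 1 (extend 𝟙S) (+ n)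
  Q-coeff f isQ = ⊛-cancelʳ {f} {h} {Den p q} (Den-0 (ℕ.<⇒≤ 1<p) 1≤q) (λ n → trans (isQ n) (sym (h⊛Den≡Num n)))
    where
    Ŝ : ℤ → ℤ
    Ŝ = extend 𝟙S
    h : Poly
    h n = Δ 1 Ŝ (+ n)
    h⊛Den≡Num : ∀ n → (h ⊛ Den p q) n ≡ Num p q n
    h⊛Den≡Num n = begin
      (h ⊛ Den p q) n                   ≡⟨ ⊛-Den h p q n ⟩
      Δ q (Δ p (extend h)) (+ n)        ≡⟨ Δ-cong q (Δ-cong p (sym ∘ Δ-extend 1 𝟙S (λ _ → refl))) (+ n) ⟩
      Δ q (Δ p (Δ 1 Ŝ)) (+ n)           ≡⟨ Δ-cong q (Δ-comm p 1 Ŝ) (+ n) ⟩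
      Δ q (Δ 1 (Δ p Ŝ)) (+ n)           ≡⟨ Δ-comm q 1 (Δ p Ŝ) (+ n) ⟩
      Δ 1 (Δ q (Δ p Ŝ)) (+ n)           ≡⟨ Δ-cong 1 (λ k → trans (Δ-cong q Δp-𝟙S k) (Δq-𝟙Ap k)) (+ n) ⟩
      Δ 1 (extend (1-X^ (p ℕ.* q))) (+ n) ≡⟨ ⊛-1-X^ (1-X^ (p ℕ.* q)) 1 n ⟨
      Num p q n                         ∎
      where open ≡-Reasoning

  Consecutive : ℕ → ℕ → Set
  Consecutive x y = x < y × InS x × InS y × (∀ k → x < k → k < y → ¬ InS k)

  Distance : ℕ → Set
  Distance d = ∃[ x ] Consecutive x (x ℕ.+ d)

module Symmetry (p q : ℕ) (1<p : 1 < p) (p≤q : p ≤ q) (p⊥q : Coprime p q) where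
  open import Data.Nat.Base using (_+_; _*_)
  open Modular p
  open NumericalSemigroup p q 1<p p≤q p⊥q

  Frobenius : ℕ
  Frobenius = ℕ.pred p * q ∸ p

  private
    Frobenius+p : Frobenius + p ≡ ℕ.pred p * q
    Frobenius+p = ℕ.m∸n+n≡m (ℕ.≤-trans p≤q (ℕ.m≤n*m q (ℕ.pred p) ⦃ ℕ.>-nonZero (ℕ.pred-mono-≤ 1<p) ⦄))

    qCoeff≤pred[p] : ∀ n → qCoeff n ≤ ℕ.pred p
    qCoeff≤pred[p] n = ℕ.pred-mono-≤ (qCoeff<p n)

  module _ {a c : ℕ} (a+c≡F : a + c ≡ Frobenius) where
    private
      j j′ : ℕ
      j  = qCoeff a
      j′ = ℕ.pred p ∸ j

      qCoeffs-sum : j′ * q + j * q ≡ c + (p + a)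
      qCoeffs-sum = begin
        j′ * q + j * q   ≡⟨ ℕ.*-distribʳ-+ q j′ j ⟨
        (j′ + j) * q     ≡⟨ cong (_* q) (ℕ.m∸n+n≡m (qCoeff≤pred[p] a)) ⟩
        ℕ.pred p * q     ≡⟨ Frobenius+p ⟨
        Frobenius + p    ≡⟨ cong (_+ p) a+c≡F ⟨
        a + c + p        ≡⟨ rearrange a c p ⟩
        c + (p + a)      ∎
        where
        open ≡-Reasoning
        rearrange : ∀ a c p → a + c + p ≡ c + (p + a)
        rearrange = NS.solve-∀

      qCoeff-c : j′ ≡ qCoeff c
      qCoeff-c = qCoeff-unique {n = c} (ℕ.≤-<-trans (ℕ.m∸n≤m (ℕ.pred p) j) pred[p]<p)
                   (cancelʳ-≈ qCoeffs-sum (≈-trans (qCoeff-correct a) (≈-sym (+p≈ a))))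

    InS⇒complement∉ : InS a → ¬ InS c
    InS⇒complement∉ a∈S c∈S = ℕ.<⇒≱ (ℕ.+-monoʳ-< c (ℕ.m<n+m a 0<p)) (begin
      c + (p + a)      ≡⟨ qCoeffs-sum ⟨
      j′ * q + j * q   ≤⟨ ℕ.+-mono-≤ (subst (λ i → i * q ≤ c) (sym qCoeff-c) c∈S) a∈S ⟩
      c + a            ∎)
      where open ℕ.≤-Reasoning

    ∉S⇒complement∈ : ¬ InS a → InS c
    ∉S⇒complement∈ a∉S = subst (λ i → i * q ≤ c) qCoeff-c (ℕ.+-cancelʳ-≤ (j * q) (j′ * q) c (begin
      j′ * q + j * q   ≡⟨ qCoeffs-sum ⟩
      c + (p + a)      ≤⟨ ℕ.+-monoʳ-≤ c p+a≤jq ⟩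
      c + j * q        ∎))
      where
      open ℕ.≤-Reasoning
      p+a≤jq : p + a ≤ j * q
      p+a≤jq = subst (_≤ j * q) (ℕ.+-comm a p) (congruent-separated (≈-sym (qCoeff-correct a)) (ℕ.≰⇒> a∉S))

  InS-above-Frobenius : ∀ {n} → Frobenius < n → InS n
  InS-above-Frobenius {n} F<n with InS? n
  ... | yes n∈S = n∈S
  ... | no  n∉S = ⊥-elim (ℕ.<⇒≱ F<n (ℕ.+-cancelʳ-≤ p n Frobenius (begin
    n + p               ≤⟨ congruent-separated (≈-sym (qCoeff-correct n)) (ℕ.≰⇒> n∉S) ⟩
    qCoeff n * q        ≤⟨ ℕ.*-monoˡ-≤ q (qCoeff≤pred[p] n) ⟩
    ℕ.pred p * q        ≡⟨ Frobenius+p ⟨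
    Frobenius + p       ∎)))
    where open ℕ.≤-Reasoning

module Gaps (p q : ℕ) (1<p : 1 < p) (p≤q : p ≤ q) (p⊥q : Coprime p q) (f : Poly) (isQ : IsQ p q f) where
  open import Data.Nat.Base using (_+_; _*_)
  open Indicator
  open Convolution using (extend-≥)
  open NumericalSemigroup p q 1<p p≤q p⊥q
  open Symmetry p q 1<p p≤q p⊥q

  private
    f-suc : ∀ n → f (suc n) ≡ 𝟙S (suc n) ℤ.- 𝟙S n
    f-suc n = trans (Q-coeff f isQ (suc n)) (cong (λ x → 𝟙S (suc n) ℤ.- x) (extend-≥ 𝟙S {suc n} {1} (s≤s z≤n)))

    f≡0⇒same : ∀ n → f (suc n) ≡ 0ℤ → InS (suc n) ⇔ InS n
    f≡0⇒same n f≡0 = 𝟙-difference≡0 (InS? (suc n)) (InS? n) (trans (sym (f-suc n)) f≡0)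

    f≢0⇔flip : ∀ n → f (suc n) ≢ 0ℤ ⇔ (InS (suc n) ⇔ (¬ InS n))
    f≢0⇔flip n = subst (λ x → x ≢ 0ℤ ⇔ _) (sym (f-suc n)) (𝟙-difference≢0 (InS? (suc n)) (InS? n))

    f≢0∧n∈S⇒1+n∉S : ∀ {n} → f (suc n) ≢ 0ℤ → InS n → ¬ InS (suc n)
    f≢0∧n∈S⇒1+n∉S {n} f≢0 n∈S 1+n∈S = Equivalence.to (Equivalence.to (f≢0⇔flip n) f≢0) 1+n∈S n∈S

    f≢0∧n∉S⇒1+n∈S : ∀ {n} → f (suc n) ≢ 0ℤ → ¬ InS n → InS (suc n)
    f≢0∧n∉S⇒1+n∈S {n} f≢0 = Equivalence.from (Equivalence.to (f≢0⇔flip n) f≢0)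

    f≢0∧1+n∈S⇒n∉S : ∀ {n} → f (suc n) ≢ 0ℤ → InS (suc n) → ¬ InS n
    f≢0∧1+n∈S⇒n∉S {n} f≢0 = Equivalence.to (Equivalence.to (f≢0⇔flip n) f≢0)

    f≢0∧1+n∉S⇒n∈S : ∀ {n} → f (suc n) ≢ 0ℤ → ¬ InS (suc n) → InS n
    f≢0∧1+n∉S⇒n∈S {n} f≢0 1+n∉S with InS? n
    ... | yes n∈S = n∈S
    ... | no  n∉S = ⊥-elim (1+n∉S (f≢0∧n∉S⇒1+n∈S f≢0 n∉S))

    flip⇒f≢0 : ∀ {n} → InS (suc n) ⇔ (¬ InS n) → f (suc n) ≢ 0ℤ
    flip⇒f≢0 {n} = Equivalence.from (f≢0⇔flip n)

    constant-between : ∀ {e e′} → (∀ k → e < k → k < e′ → f k ≡ 0ℤ) →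
                       ∀ k → e ≤ k → k < e′ → InS k ⇔ InS e
    constant-between zeros zero    z≤n _ = ⇔.refl
    constant-between zeros (suc k) e≤1+k 1+k<e′ with ℕ.m≤n⇒m<n∨m≡n e≤1+k
    ... | inj₂ refl  = ⇔.refl
    ... | inj₁ e<1+k = ⇔.trans (f≡0⇒same k (zeros (suc k) e<1+k 1+k<e′))
                               (constant-between zeros k (ℕ.≤-pred e<1+k) (ℕ.<-trans (ℕ.n<1+n k) 1+k<e′))

  consecutive⇒gap : ∀ {x y} → Consecutive x y → suc x < y → InGapset f (y ∸ suc x)
  consecutive⇒gap {x} {suc y₀} (_ , x∈S , y∈S , between) 1+x<y =
    suc x , suc y₀ , 1+x<y , f≢0-at-1+x , f≢0-at-y , zeros , refl
    where
    x<y₀ : x < y₀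
    x<y₀ = ℕ.≤-pred 1+x<y
    f≢0-at-1+x : f (suc x) ≢ 0ℤ
    f≢0-at-1+x = flip⇒f≢0 (mk⇔ (λ 1+x∈S → ⊥-elim (between (suc x) ℕ.≤-refl 1+x<y 1+x∈S))
                                (λ x∉S → ⊥-elim (x∉S x∈S)))
    f≢0-at-y : f (suc y₀) ≢ 0ℤ
    f≢0-at-y = flip⇒f≢0 (mk⇔ (λ _ → between y₀ x<y₀ ℕ.≤-refl) (λ _ → y∈S))
    zeros : ∀ k → suc x < k → k < suc y₀ → f k ≡ 0ℤ
    zeros (suc k) 1+x<1+k 1+k<y = trans (f-suc k) (cong₂ ℤ._-_
      (𝟙-no (InS? (suc k)) (between (suc k) (ℕ.<-trans (ℕ.n<1+n x) 1+x<1+k) 1+k<y))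
      (𝟙-no (InS? k) (between k (ℕ.≤-pred 1+x<1+k) (ℕ.<-trans (ℕ.n<1+n k) 1+k<y))))

  private
    hole : ∀ e w → f e ≢ 0ℤ → f (suc (e + w)) ≢ 0ℤ →
           (∀ k → e ≤ k → k ≤ e + w → ¬ InS k) → Distance (suc (suc w))
    hole zero     w _ _ hole∉S = ⊥-elim (hole∉S 0 z≤n z≤n InS-0)
    hole (suc e₀) w f≢0-at-e f≢0-at-e′ hole∉S =
      e₀ , subst (Consecutive e₀) (rearrange e₀ w) (x<y , x∈S , y∈S , between)
      where
      rearrange : ∀ e₀ w → suc (suc e₀ + w) ≡ e₀ + suc (suc w)
      rearrange = NS.solve-∀
      x<y : e₀ < suc (suc e₀ + w)
      x<y = ℕ.≤-trans (ℕ.n<1+n e₀) (ℕ.m≤n⇒m≤1+n (ℕ.m≤m+n (suc e₀) w))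
      x∈S : InS e₀
      x∈S = f≢0∧1+n∉S⇒n∈S f≢0-at-e (hole∉S (suc e₀) ℕ.≤-refl (ℕ.m≤m+n (suc e₀) w))
      y∈S : InS (suc (suc e₀ + w))
      y∈S = f≢0∧n∉S⇒1+n∈S f≢0-at-e′ (hole∉S (suc e₀ + w) (ℕ.m≤m+n (suc e₀) w) ℕ.≤-refl)
      between : ∀ k → e₀ < k → k < suc (suc e₀ + w) → ¬ InS k
      between k e₀<k k<y = hole∉S k e₀<k (ℕ.≤-pred k<y)

    -- The symmetry n ↦ Frobenius ∸ n turns the run [e, e + w] into a hole of the same length.
    run : ∀ e w → f e ≢ 0ℤ → f (suc (e + w)) ≢ 0ℤ →
          (∀ k → e ≤ k → k ≤ e + w → InS k) → Distance (suc (suc w))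
    run e w f≢0-at-e f≢0-at-e′ run∈S = x , ℕ.m<m+n x (s≤s z≤n) , x∈S , y∈S e f≢0-at-e e∈S e′+x≡F , between
      where
      e∈S : InS e
      e∈S = run∈S e ℕ.≤-refl (ℕ.m≤m+n e w)
      e′∉S : ¬ InS (suc (e + w))
      e′∉S = f≢0∧n∈S⇒1+n∉S f≢0-at-e′ (run∈S (e + w) (ℕ.m≤m+n e w) ℕ.≤-refl)
      e′≤F : suc (e + w) ≤ Frobenius
      e′≤F = ℕ.≮⇒≥ (λ F<e′ → e′∉S (InS-above-Frobenius F<e′))
      x : ℕ
      x = proj₁ (ℕ.m≤n⇒∃[o]m+o≡n e′≤F)
      e′+x≡F : suc (e + w) + x ≡ Frobenius
      e′+x≡F = proj₂ (ℕ.m≤n⇒∃[o]m+o≡n e′≤F)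
      x∈S : InS x
      x∈S = ∉S⇒complement∈ e′+x≡F e′∉S
      y∈S : ∀ e → f e ≢ 0ℤ → InS e → suc (e + w) + x ≡ Frobenius → InS (x + suc (suc w))
      y∈S zero     _        _  e′+x≡F =
        InS-above-Frobenius (subst (_< x + suc (suc w)) e′+x≡F (ℕ.≤-reflexive (rearrange w x)))
        where
        rearrange : ∀ w x → suc (suc (w + x)) ≡ x + suc (suc w)
        rearrange = NS.solve-∀
      y∈S (suc e₀) f≢0-at-e e∈S e′+x≡F =
        ∉S⇒complement∈ (trans (rearrange e₀ w x) e′+x≡F) (f≢0∧1+n∈S⇒n∉S f≢0-at-e e∈S)
        where
        rearrange : ∀ e₀ w x → e₀ + (x + suc (suc w)) ≡ suc (suc e₀ + w) + x
        rearrange = NS.solve-∀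
      v≤w : ∀ v → suc (x + v) < x + suc (suc w) → v ≤ w
      v≤w v lt = ℕ.≤-pred (ℕ.≤-pred (ℕ.+-cancelˡ-≤ x _ _ (subst (_≤ x + suc (suc w)) (rearrange x v) lt)))
        where
        rearrange : ∀ x v → suc (suc (x + v)) ≡ x + suc (suc v)
        rearrange = NS.solve-∀
      between : ∀ k → x < k → k < x + suc (suc w) → ¬ InS k
      between k x<k k<y with ℕ.m≤n⇒∃[o]m+o≡n x<k
      ... | v , refl with ℕ.m≤n⇒∃[o]m+o≡n (v≤w v k<y)
      ...   | u , v+u≡w = InS⇒complement∉ (trans (rearrange e u x v) (trans (cong (λ w → suc (e + w) + x) v+u≡w) e′+x≡F))
                            (run∈S (e + u) (ℕ.m≤m+n e u) (ℕ.+-monoʳ-≤ e (subst (u ≤_) v+u≡w (ℕ.m≤n+m u v))))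
        where
        rearrange : ∀ e u x v → e + u + suc (x + v) ≡ suc (e + (v + u)) + x
        rearrange = NS.solve-∀

  gap⇒distance : ∀ {g} → InGapset f g → Distance (suc g)
  gap⇒distance {g} (e , e′ , e<e′ , f≢0-at-e , f≢0-at-e′ , zeros , g≡e′∸e) with ℕ.m≤n⇒∃[o]m+o≡n e<e′
  ... | w , refl = subst (Distance ∘ suc) (sym g≡1+w) (by-membership (InS? e))
    where
    g≡1+w : g ≡ suc w
    g≡1+w = trans g≡e′∸e (trans (cong (_∸ e) (sym (ℕ.+-suc e w))) (ℕ.m+n∸m≡n e (suc w)))
    constant : ∀ k → e ≤ k → k ≤ e + w → InS k ⇔ InS e
    constant k e≤k k≤e+w = constant-between zeros k e≤k (s≤s k≤e+w)
    by-membership : Dec (InS e) → Distance (suc (suc w))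
    by-membership (yes e∈S) = run e w f≢0-at-e f≢0-at-e′ (λ k e≤k k≤e+w → Equivalence.from (constant k e≤k k≤e+w) e∈S)
    by-membership (no  e∉S) = hole e w f≢0-at-e f≢0-at-e′ (λ k e≤k k≤e+w → e∉S ∘ Equivalence.to (constant k e≤k k≤e+w))

  gap⇔distance : ∀ g → InGapset f g ⇔ (1 ≤ g × Distance (suc g))
  gap⇔distance g = mk⇔
    (λ gap@(e , e′ , e<e′ , _ , _ , _ , g≡e′∸e) →
      subst (1 ≤_) (sym g≡e′∸e) (ℕ.m<n⇒0<n∸m e<e′) , gap⇒distance gap)
    (λ (1≤g , x , consecutive) → subst (InGapset f) (x+1+g∸1+x≡g x)
      (consecutive⇒gap consecutive (subst (suc x <_) (sym (ℕ.+-suc x g)) (s≤s (ℕ.m<m+n x 1≤g)))))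
    where
    x+1+g∸1+x≡g : ∀ x → x + suc g ∸ suc x ≡ g
    x+1+g∸1+x≡g x = trans (cong (_∸ suc x) (ℕ.+-suc x g)) (ℕ.m+n∸m≡n x g)

module ConsecutiveDistances (p q : ℕ) (1<p : 1 < p) (p≤q : p ≤ q) (p⊥q : Coprime p q) where
  open import Data.Integer.Base using (_+_; _*_; -_; _-_; -1ℤ)
  open Casts
  open Modular p
  open NumericalSemigroup p q 1<p p≤q p⊥q

  Least : ℤ → ℕ → ℕ → Set
  Least c δ A = ∀ {δ′ ρ} → 1 ≤ δ′ → δ′ ≤ δ → + ρ ≈ c * (+ δ′ * + q) → A ≤ ρ

  private
    ≈qCoeff : ∀ n → + n ≈ + qCoeff n * + q
    ≈qCoeff n = ≈-sym (≈-trans (≈-reflexive (sym (ℤ.pos-* (qCoeff n) q))) (qCoeff-correct n))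

    InS-intro′ : ∀ {j n} → j < p → + n ≈ + j * + q → j ℕ.* q ≤ n → InS n
    InS-intro′ {j} j<p n≈jq = InS-intro j<p (≈-trans (≈-reflexive (ℤ.pos-* j q)) (≈-sym n≈jq))

    no-small-multiple : ∀ {k} → 0 < k → k < p → ¬ (+ k ≈ 0ℤ)
    no-small-multiple {k} 0<k k<p k≈0 = ℕ.<⇒≱ k<p (congruent-separated (≈-sym k≈0) 0<k)

    difference≈ : ∀ {x d} → + d ≈ + qCoeff (x ℕ.+ d) * + q - + qCoeff x * + q
    difference≈ {x} {d} = split-≈ (≈qCoeff (x ℕ.+ d)) (≈qCoeff x)

  least-one : ∀ {c δ} → c ≡ 1ℤ ⊎ c ≡ -1ℤ → δ < p → Least c δ 1
  least-one {c} {δ} c≡±1 δ<p {δ′} {zero} 1≤δ′ δ′≤δ 0≈cδ′q = ⊥-elim (ℕ.<⇒≢ 1≤δ′ (sym (trans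
    (qCoeff-unique (ℕ.≤-<-trans δ′≤δ δ<p) (≈-trans (≈-reflexive (ℤ.pos-* δ′ q)) (unsign c≡±1 0≈cδ′q)))
    (sym (qCoeff-unique 0<p ≈-refl)))))
    where
    unsign : ∀ {c X} → c ≡ 1ℤ ⊎ c ≡ -1ℤ → 0ℤ ≈ c * X → X ≈ 0ℤ
    unsign {X = X} (inj₁ refl) 0≈X = ≈-sym (≈-trans 0≈X (≈-reflexive (ℤ.*-identityˡ X)))
    unsign {X = X} (inj₂ refl) 0≈-X = ≈-sym (≈-trans (-‿cong 0≈-X) (≈-reflexive (negate X)))
      where
      negate : ∀ X → - (-1ℤ * X) ≡ X
      negate = solve-∀
  least-one _ _ {ρ = suc _} _ _ _ = s≤s z≤n

  distance≤p : ∀ {x d} → Consecutive x (x ℕ.+ d) → d ≤ p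
  distance≤p {x} {d} (_ , x∈S , _ , between) = ℕ.≮⇒≥ (λ p<d →
    between (x ℕ.+ p) (ℕ.m<m+n x 0<p) (ℕ.+-monoʳ-< x p<d) (subst InS (ℕ.+-comm p x) (InS-+p x∈S)))

  distance-same-qCoeff : ∀ {x d} → Consecutive x (x ℕ.+ d) → qCoeff x ≡ qCoeff (x ℕ.+ d) → d ≡ p
  distance-same-qCoeff {x} {d} consecutive@(x<x+d , _) same =
    ℕ.≤-antisym (distance≤p consecutive) (congruent-separated 0≈d 0<d)
    where
    0<d : 0 < d
    0<d = ℕ.+-cancelˡ-< x 0 d (subst (_< x ℕ.+ d) (sym (ℕ.+-identityʳ x)) x<x+d)
    0≈d : + 0 ≈ + d
    0≈d = ≈-sym (≈-trans (difference≈ {x}) (≈-reflexive (trans (cong (λ j → + j * + q - + qCoeff x * + q) (sym same))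
                                                             (ℤ.+-inverseʳ (+ qCoeff x * + q)))))

  distance-up : ∀ {x d A σ} → Consecutive x (x ℕ.+ d) → qCoeff x < qCoeff (x ℕ.+ d) → 1 ≤ A →
                σ ≤ qCoeff (x ℕ.+ d) ∸ qCoeff x → + A ≈ 1ℤ * (+ σ * + q) →
                Least 1ℤ (qCoeff (x ℕ.+ d) ∸ qCoeff x) A → d ≡ A
  distance-up {x} {d} {A} {σ} consecutive@(_ , _ , x+d∈S , between) i<j 1≤A σ≤j-i A≈σq least =
    ℕ.≤-antisym (ℕ.≮⇒≥ A≮d) (least (ℕ.m<n⇒0<n∸m i<j) ℕ.≤-refl d≈[j-i]q)
    where
    i j : ℕ
    i = qCoeff x
    j = qCoeff (x ℕ.+ d)
    i+σ≤j : i ℕ.+ σ ≤ j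
    i+σ≤j = subst (i ℕ.+ σ ≤_) (ℕ.m+[n∸m]≡n (ℕ.<⇒≤ i<j)) (ℕ.+-monoʳ-≤ i σ≤j-i)
    d≈[j-i]q : + d ≈ 1ℤ * (+ (j ∸ i) * + q)
    d≈[j-i]q = ≈-trans (difference≈ {x}) (≈-reflexive (trans (factor (+ j) (+ i) (+ q))
                 (cong (λ k → 1ℤ * (k * + q)) (sym (pos-∸ (ℕ.<⇒≤ i<j))))))
      where
      factor : ∀ j i q → j * q - i * q ≡ 1ℤ * ((j - i) * q)
      factor = solve-∀
    x+A≈[i+σ]q : + (x ℕ.+ A) ≈ + (i ℕ.+ σ) * + q
    x+A≈[i+σ]q = ≈-trans (join-≈ (≈qCoeff x) A≈σq) (≈-reflexive (trans (factor (+ i) (+ σ) (+ q))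
                   (cong (_* + q) (sym (ℤ.pos-+ i σ)))))
      where
      factor : ∀ i σ q → i * q + 1ℤ * (σ * q) ≡ (i + σ) * q
      factor = solve-∀
    A≮d : ¬ (A < d)
    A≮d A<d with ℕ.m≤n⇒m<n∨m≡n i+σ≤j
    ... | inj₁ i+σ<j = between (x ℕ.+ A) (ℕ.m<m+n x 1≤A) (ℕ.+-monoʳ-< x A<d)
                         (InS-intro′ (ℕ.<-trans i+σ<j (qCoeff<p (x ℕ.+ d))) x+A≈[i+σ]q
                                     (ℕ.≤-trans [i+σ]q≤x (ℕ.m≤m+n x A)))
      where
      open ℕ.≤-Reasoning
      [i+σ]q≤x : (i ℕ.+ σ) ℕ.* q ≤ x
      [i+σ]q≤x = ℕ.+-cancelʳ-≤ q _ x (begin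
        (i ℕ.+ σ) ℕ.* q ℕ.+ q ≡⟨ ℕ.+-comm _ q ⟩
        suc (i ℕ.+ σ) ℕ.* q   ≤⟨ ℕ.*-monoˡ-≤ q i+σ<j ⟩
        j ℕ.* q               ≤⟨ x+d∈S ⟩
        x ℕ.+ d               ≤⟨ ℕ.+-monoʳ-≤ x (ℕ.≤-trans (distance≤p consecutive) p≤q) ⟩
        x ℕ.+ q               ∎)
    ... | inj₂ i+σ≡j = ℕ.<⇒≱ (ℕ.m<n+m p 1≤A)
                         (ℕ.≤-trans (ℕ.+-cancelˡ-≤ x (A ℕ.+ p) d x+A+p≤x+d) (distance≤p consecutive))
      where
      x+A+p≤x+d : x ℕ.+ (A ℕ.+ p) ≤ x ℕ.+ d
      x+A+p≤x+d = subst (_≤ x ℕ.+ d) (ℕ.+-assoc x A p) (congruent-separated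
        (≈-trans x+A≈[i+σ]q (≈-trans (≈-reflexive (cong (λ k → + k * + q) i+σ≡j)) (≈-sym (≈qCoeff (x ℕ.+ d)))))
        (ℕ.+-monoʳ-< x A<d))

  distance-down : ∀ {x d A σ} → Consecutive x (x ℕ.+ d) → qCoeff (x ℕ.+ d) < qCoeff x → 1 ≤ A →
                  σ ≤ qCoeff x ∸ qCoeff (x ℕ.+ d) → + A ≈ -1ℤ * (+ σ * + q) →
                  Least -1ℤ (qCoeff x ∸ qCoeff (x ℕ.+ d)) A → d ≡ A
  distance-down {x} {d} {A} {σ} (_ , x∈S , _ , between) j<i 1≤A σ≤i-j A≈-σq least =
    ℕ.≤-antisym (ℕ.≮⇒≥ A≮d) (least (ℕ.m<n⇒0<n∸m j<i) ℕ.≤-refl d≈-[i-j]q)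
    where
    i j : ℕ
    i = qCoeff x
    j = qCoeff (x ℕ.+ d)
    σ≤i : σ ≤ i
    σ≤i = ℕ.≤-trans σ≤i-j (ℕ.m∸n≤m i j)
    d≈-[i-j]q : + d ≈ -1ℤ * (+ (i ∸ j) * + q)
    d≈-[i-j]q = ≈-trans (difference≈ {x}) (≈-reflexive (trans (factor (+ j) (+ i) (+ q))
                  (cong (λ k → -1ℤ * (k * + q)) (sym (pos-∸ (ℕ.<⇒≤ j<i))))))
      where
      factor : ∀ j i q → j * q - i * q ≡ -1ℤ * ((i - j) * q)
      factor = solve-∀
    x+A≈[i-σ]q : + (x ℕ.+ A) ≈ + (i ∸ σ) * + q
    x+A≈[i-σ]q = ≈-trans (join-≈ (≈qCoeff x) A≈-σq) (≈-reflexive (trans (factor (+ i) (+ σ) (+ q))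
                   (cong (_* + q) (sym (pos-∸ σ≤i)))))
      where
      factor : ∀ i σ q → i * q + -1ℤ * (σ * q) ≡ (i - σ) * q
      factor = solve-∀
    A≮d : ¬ (A < d)
    A≮d A<d = between (x ℕ.+ A) (ℕ.m<m+n x 1≤A) (ℕ.+-monoʳ-< x A<d)
      (InS-intro′ (ℕ.≤-<-trans (ℕ.m∸n≤m i σ) (qCoeff<p x)) x+A≈[i-σ]q
        (ℕ.≤-trans (ℕ.*-monoˡ-≤ q (ℕ.m∸n≤m i σ)) (ℕ.≤-trans x∈S (ℕ.m≤m+n x A))))

  private
    offset≈ : ∀ {x k X Y} → x ≤ k → + k ≈ X → + x ≈ Y → + (k ∸ x) ≈ X - Y
    offset≈ {x} {k} x≤k k≈X x≈Y = split-≈ (subst (λ n → + n ≈ _) (sym (ℕ.m+[n∸m]≡n x≤k)) k≈X) x≈Y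

    offset< : ∀ {x k A} → x ≤ k → k < x ℕ.+ A → k ∸ x < A
    offset< {x} {k} {A} x≤k k<x+A = subst (k ∸ x <_) (ℕ.m+n∸m≡n x A) (ℕ.∸-monoˡ-< k<x+A x≤k)

  residue-down⇒consecutive : ∀ {A σ} → σ < p → 1 ≤ A → A ≤ p → + A ≈ -1ℤ * (+ σ * + q) → Least -1ℤ σ A →
                             Consecutive (σ ℕ.* q) (σ ℕ.* q ℕ.+ A)
  residue-down⇒consecutive {A} {σ} σ<p 1≤A A≤p A≈-σq least =
    ℕ.m<m+n x 1≤A , InS-intro σ<p ≈-refl ℕ.≤-refl , InS-intro′ 0<p x+A≈0 z≤n , between
    where
    x : ℕ
    x = σ ℕ.* q
    x+A≈0 : + (x ℕ.+ A) ≈ 0ℤ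
    x+A≈0 = ≈-trans (join-≈ (≈-reflexive (ℤ.pos-* σ q)) A≈-σq) (≈-reflexive (cancel (+ σ * + q)))
      where
      cancel : ∀ x → x + -1ℤ * x ≡ 0ℤ
      cancel = solve-∀
    between : ∀ k → x < k → k < x ℕ.+ A → ¬ InS k
    between k x<k k<x+A k∈S with ℕ.<-cmp (qCoeff k) σ
    ... | tri< j<σ _ _ = ℕ.<⇒≱ k-x<A (least (ℕ.m<n⇒0<n∸m j<σ) (ℕ.m∸n≤m σ (qCoeff k)) (≈-trans k-x≈
                           (≈-reflexive (trans (factor (+ qCoeff k) (+ σ) (+ q))
                                               (cong (λ n → -1ℤ * (n * + q)) (sym (pos-∸ (ℕ.<⇒≤ j<σ))))))))
      where
      factor : ∀ j σ q → j * q - σ * q ≡ -1ℤ * ((σ - j) * q)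
      factor = solve-∀
      k-x<A : k ∸ x < A
      k-x<A = offset< (ℕ.<⇒≤ x<k) k<x+A
      k-x≈ : + (k ∸ x) ≈ + qCoeff k * + q - + σ * + q
      k-x≈ = offset≈ (ℕ.<⇒≤ x<k) (≈qCoeff k) (≈-reflexive (ℤ.pos-* σ q))
    ... | tri≈ _ j≡σ _ = no-small-multiple (ℕ.m<n⇒0<n∸m x<k) (ℕ.<-≤-trans (offset< (ℕ.<⇒≤ x<k) k<x+A) A≤p)
          (≈-trans (offset≈ (ℕ.<⇒≤ x<k) (≈qCoeff k) (≈-reflexive (ℤ.pos-* σ q)))
                   (≈-reflexive (trans (cong (λ j → + j * + q - + σ * + q) j≡σ) (ℤ.+-inverseʳ (+ σ * + q)))))
    ... | tri> _ _ σ<j = ℕ.<⇒≱ k<x+A (begin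
      x ℕ.+ A          ≤⟨ ℕ.+-monoʳ-≤ x (ℕ.≤-trans A≤p p≤q) ⟩
      x ℕ.+ q          ≡⟨ ℕ.+-comm x q ⟩
      suc σ ℕ.* q      ≤⟨ ℕ.*-monoˡ-≤ q σ<j ⟩
      qCoeff k ℕ.* q   ≤⟨ k∈S ⟩
      k                ∎)
      where open ℕ.≤-Reasoning

  residue-up⇒distance : ∀ {A σ} → 1 ≤ σ → σ < p → 1 ≤ A → A ≤ p → + A ≈ 1ℤ * (+ σ * + q) → Least 1ℤ σ A →
                        Distance A
  residue-up⇒distance {A} {σ} 1≤σ σ<p 1≤A A≤p A≈σq least =
    x , ℕ.m<m+n x 1≤A , InS-intro′ 0<p x≈0 z≤n , subst InS (sym x+A≡σq) (InS-intro σ<p ≈-refl ℕ.≤-refl) , between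
    where
    A≤σq : A ≤ σ ℕ.* q
    A≤σq = ℕ.≤-trans A≤p (ℕ.≤-trans p≤q (ℕ.m≤n*m q σ ⦃ ℕ.>-nonZero 1≤σ ⦄))
    x : ℕ
    x = σ ℕ.* q ∸ A
    x+A≡σq : x ℕ.+ A ≡ σ ℕ.* q
    x+A≡σq = ℕ.m∸n+n≡m A≤σq
    x≈0 : + x ≈ 0ℤ
    x≈0 = ≈-trans (split-≈ {A} {x} (≈-reflexive (trans (cong +_ (trans (ℕ.+-comm A x) x+A≡σq)) (ℤ.pos-* σ q))) A≈σq)
                  (≈-reflexive (cancel (+ σ * + q)))
      where
      cancel : ∀ x → x - 1ℤ * x ≡ 0ℤ
      cancel = solve-∀
    between : ∀ k → x < k → k < x ℕ.+ A → ¬ InS k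
    between k x<k k<x+A k∈S = by-qCoeff (qCoeff k) refl
      where
      k-x<A : k ∸ x < A
      k-x<A = offset< (ℕ.<⇒≤ x<k) k<x+A
      k-x≈ : + (k ∸ x) ≈ + qCoeff k * + q - 0ℤ
      k-x≈ = offset≈ (ℕ.<⇒≤ x<k) (≈qCoeff k) x≈0
      by-qCoeff : ∀ j → qCoeff k ≡ j → ⊥
      by-qCoeff zero    qCoeff-k≡0 = no-small-multiple (ℕ.m<n⇒0<n∸m x<k) (ℕ.<-≤-trans k-x<A A≤p)
        (≈-trans k-x≈ (≈-reflexive (cong (λ j → + j * + q - 0ℤ) qCoeff-k≡0)))
      by-qCoeff (suc j) qCoeff-k≡1+j = ℕ.<⇒≱ k-x<A (least (s≤s z≤n) 1+j≤σ
        (≈-trans k-x≈ (≈-reflexive (trans (cong (λ j → + j * + q - 0ℤ) qCoeff-k≡1+j) (shift (+ suc j * + q))))))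
        where
        shift : ∀ x → x - 0ℤ ≡ 1ℤ * x
        shift = solve-∀
        1+j≤σ : suc j ≤ σ
        1+j≤σ = ℕ.<⇒≤ (ℕ.*-cancelʳ-< q (suc j) σ (begin-strict
          suc j ℕ.* q     ≡⟨ cong (ℕ._* q) qCoeff-k≡1+j ⟨
          qCoeff k ℕ.* q  ≤⟨ k∈S ⟩
          k               <⟨ k<x+A ⟩
          x ℕ.+ A         ≡⟨ x+A≡σq ⟩
          σ ℕ.* q         ∎))
          where open ℕ.≤-Reasoning

module Euclid (p q : ℕ) (1<p : 1 < p) (p≤q : p ≤ q) (p⊥q : Coprime p q)
              (t₀ : ℕ) (r Z : ℕ → ℕ) (r0≡p : r 0 ≡ p) (r1<p : r 1 < p) (q≡kp+r1 : ∃[ k ] q ≡ k ℕ.* p ℕ.+ r 1)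
              (division : ∀ i → 1 ≤ i → i ≤ suc t₀ → r (i ∸ 1) ≡ Z i ℕ.* r i ℕ.+ r (suc i) × r (suc i) < r i)
              (r[t]≡1 : r (suc t₀) ≡ 1) where
  open import Data.Integer.Base using (_+_; _*_; -_; _-_; -1ℤ)
  open import Data.Nat.DivMod using (_/_; _%_; m≡m%n+[m/n]*n; m%n<n; m/n*n≤m)
  open import Data.List.Base using (List; []; _∷_; _++_; applyUpTo; length)
  open import Data.List.Properties using (length-++; length-applyUpTo; applyUpTo-∷ʳ)
  open import Data.List.Membership.Propositional using (_∈_)
  open import Data.List.Membership.Propositional.Properties using (∈-++⁺ˡ; ∈-++⁺ʳ; ∈-++⁻; ∈-applyUpTo⁺; ∈-applyUpTo⁻)
  open import Data.List.Relation.Unary.Unique.Propositional using (Unique)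
  import Data.List.Relation.Unary.AllPairs as AllPairs
  import Data.List.Relation.Unary.Unique.Propositional.Properties as Unique
  open import Data.Nat.ListAction using (sum)
  open import Data.Nat.ListAction.Properties using (sum-++)
  open Casts
  open Modular p
  open NumericalSemigroup p q 1<p p≤q p⊥q
  open ConsecutiveDistances p q 1<p p≤q p⊥q

  t : ℕ
  t = suc t₀

  step : ∀ j → j < t → r j ≡ Z (suc j) ℕ.* r (suc j) ℕ.+ r (suc (suc j)) × r (suc (suc j)) < r (suc j)
  step j = division (suc j) (s≤s z≤n)

  r-decreasing : ∀ j → j < t → r (suc j) < r j
  r-decreasing zero    _     = subst (r 1 <_) (sym r0≡p) r1<p
  r-decreasing (suc j) 1+j<t = proj₂ (step j (ℕ.<-trans (ℕ.n<1+n j) 1+j<t))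

  r≤p : ∀ j → j ≤ t → r j ≤ p
  r≤p zero    _     = ℕ.≤-reflexive r0≡p
  r≤p (suc j) 1+j≤t = ℕ.≤-trans (ℕ.<⇒≤ (r-decreasing j 1+j≤t)) (r≤p j (ℕ.<⇒≤ 1+j≤t))

  r-positive : ∀ j → j ≤ t → 1 ≤ r j
  r-positive zero    _     = subst (1 ≤_) (sym r0≡p) (ℕ.<⇒≤ 1<p)
  r-positive (suc j) 1+j≤t = ℕ.≤-trans (s≤s z≤n) (proj₂ (step j 1+j≤t))

  r[1+t]≡0 : r (suc t) ≡ 0
  r[1+t]≡0 = ℕ.n<1⇒n≡0 (subst (r (suc t) <_) r[t]≡1 (proj₂ (step t₀ ℕ.≤-refl)))

  r[t₀]≡Z[t] : r t₀ ≡ Z t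
  r[t₀]≡Z[t] = trans (proj₁ (step t₀ ℕ.≤-refl))
    (trans (cong₂ (λ a b → Z t ℕ.* a ℕ.+ b) r[t]≡1 r[1+t]≡0) (trans (ℕ.+-identityʳ _) (ℕ.*-identityʳ (Z t))))

  Z-positive : ∀ j → j < t → 1 ≤ Z (suc j)
  Z-positive j j<t with Z (suc j) | proj₁ (step j j<t)
  ... | zero  | r[j]≡r[2+j] = ⊥-elim (ℕ.<-asym (r-decreasing j j<t)
                                 (subst (_< r (suc j)) (sym r[j]≡r[2+j]) (proj₂ (step j j<t))))
  ... | suc _ | _           = s≤s z≤n

  private
    quotient-bound : ∀ {j z} → j < t → z < Z (suc j) → z ℕ.* r (suc j) ℕ.+ (r (suc j) ℕ.+ r (suc (suc j))) ≤ r j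
    quotient-bound {j} {z} j<t z<Z = begin
      z ℕ.* r (suc j) ℕ.+ (r (suc j) ℕ.+ r (suc (suc j))) ≡⟨ ℕ.+-assoc (z ℕ.* r (suc j)) _ _ ⟨
      z ℕ.* r (suc j) ℕ.+ r (suc j) ℕ.+ r (suc (suc j))   ≡⟨ cong (ℕ._+ r (suc (suc j))) (ℕ.+-comm (z ℕ.* r (suc j)) _) ⟩
      suc z ℕ.* r (suc j) ℕ.+ r (suc (suc j))             ≤⟨ ℕ.+-monoˡ-≤ _ (ℕ.*-monoˡ-≤ (r (suc j)) z<Z) ⟩
      Z (suc j) ℕ.* r (suc j) ℕ.+ r (suc (suc j))         ≡⟨ proj₁ (step j j<t) ⟨
      r j                                                 ∎
      where open ℕ.≤-Reasoning

  zr≤r : ∀ {j z} → j < t → z < Z (suc j) → z ℕ.* r (suc j) ≤ r j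
  zr≤r {j} {z} j<t z<Z = ℕ.≤-trans (ℕ.m≤m+n (z ℕ.* r (suc j)) _) (quotient-bound j<t z<Z)

  r[1+j]+r[2+j]≤ : ∀ {j z} → j < t → z < Z (suc j) → r (suc j) ℕ.+ r (suc (suc j)) ≤ r j ∸ z ℕ.* r (suc j)
  r[1+j]+r[2+j]≤ {j} {z} j<t z<Z = ℕ.m+n≤o⇒m≤o∸n (r (suc j) ℕ.+ r (suc (suc j)))
    (subst (ℕ._≤ r j) (ℕ.+-comm (z ℕ.* r (suc j)) _) (quotient-bound j<t z<Z))

  -- The continuants of the partial quotients Z.
  s : ℕ → ℕ
  s zero          = 0
  s (suc zero)    = 1
  s (suc (suc j)) = s j ℕ.+ Z (suc j) ℕ.* s (suc j)

  s-positive : ∀ j → j ≤ t → 1 ≤ s (suc j)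
  s-positive zero    _     = s≤s z≤n
  s-positive (suc j) 1+j≤t =
    ℕ.≤-trans (ℕ.*-mono-≤ (Z-positive j 1+j≤t) (s-positive j (ℕ.<⇒≤ 1+j≤t))) (ℕ.m≤n+m _ (s j))

  s-determinant : ∀ j → j ≤ t → s j ℕ.* r (suc j) ℕ.+ s (suc j) ℕ.* r j ≡ p
  s-determinant zero    _     = trans (ℕ.+-identityʳ (r 0)) r0≡p
  s-determinant (suc j) 1+j≤t = begin
    s (suc j) ℕ.* r (suc (suc j)) ℕ.+ (s j ℕ.+ Z (suc j) ℕ.* s (suc j)) ℕ.* r (suc j)
      ≡⟨ rearrange (s j) (s (suc j)) (Z (suc j)) (r (suc j)) (r (suc (suc j))) ⟩
    s j ℕ.* r (suc j) ℕ.+ s (suc j) ℕ.* (Z (suc j) ℕ.* r (suc j) ℕ.+ r (suc (suc j)))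
      ≡⟨ cong (λ x → s j ℕ.* r (suc j) ℕ.+ s (suc j) ℕ.* x) (proj₁ (step j 1+j≤t)) ⟨
    s j ℕ.* r (suc j) ℕ.+ s (suc j) ℕ.* r j
      ≡⟨ s-determinant j (ℕ.<⇒≤ 1+j≤t) ⟩
    p ∎
    where
    open ≡-Reasoning
    rearrange : ∀ a b c d e → b ℕ.* e ℕ.+ (a ℕ.+ c ℕ.* b) ℕ.* d ≡ a ℕ.* d ℕ.+ b ℕ.* (c ℕ.* d ℕ.+ e)
    rearrange = NS.solve-∀

  s[1+t]≡p : s (suc t) ≡ p
  s[1+t]≡p = begin
    s (suc t)                               ≡⟨ ℕ.*-identityʳ (s (suc t)) ⟨
    s (suc t) ℕ.* 1                          ≡⟨ cong (ℕ._+ s (suc t) ℕ.* 1) (ℕ.*-zeroʳ (s t)) ⟨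
    s t ℕ.* 0 ℕ.+ s (suc t) ℕ.* 1            ≡⟨ cong₂ (λ a b → s t ℕ.* a ℕ.+ s (suc t) ℕ.* b) r[1+t]≡0 r[t]≡1 ⟨
    s t ℕ.* r (suc t) ℕ.+ s (suc t) ℕ.* r t ≡⟨ s-determinant t ℕ.≤-refl ⟩
    p                                       ∎
    where open ≡-Reasoning

  s≤p : ∀ j → j ≤ t → s (suc j) ≤ p
  s≤p j j≤t = begin
    s (suc j)                               ≤⟨ ℕ.m≤m*n (s (suc j)) (r j) ⦃ ℕ.>-nonZero (r-positive j j≤t) ⦄ ⟩
    s (suc j) ℕ.* r j                       ≤⟨ ℕ.m≤n+m _ _ ⟩
    s j ℕ.* r (suc j) ℕ.+ s (suc j) ℕ.* r j ≡⟨ s-determinant j j≤t ⟩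
    p                                       ∎
    where open ℕ.≤-Reasoning

  ε : ℕ → ℤ
  ε zero          = 1ℤ
  ε (suc zero)    = -1ℤ
  ε (suc (suc j)) = ε j

  ε-suc : ∀ j → ε (suc j) ≡ - ε j
  ε-suc zero          = refl
  ε-suc (suc zero)    = refl
  ε-suc (suc (suc j)) = ε-suc j

  ε-cases : ∀ j → (ε j ≡ 1ℤ × ε (suc j) ≡ -1ℤ) ⊎ (ε j ≡ -1ℤ × ε (suc j) ≡ 1ℤ)
  ε-cases zero          = inj₁ (refl , refl)
  ε-cases (suc zero)    = inj₂ (refl , refl)
  ε-cases (suc (suc j)) = ε-cases j

  private
    partial-remainder≈ : ∀ j z {a} → + r j ≈ ε (suc j) * (+ s j * + q) → + r (suc j) ≈ ε (suc (suc j)) * (+ s (suc j) * + q) →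
              a ℕ.+ z ℕ.* r (suc j) ≡ r j → + a ≈ ε (suc j) * (+ (s j ℕ.+ z ℕ.* s (suc j)) * + q)
    partial-remainder≈ j z {a} r[j]≈ r[1+j]≈ a+zr≡r = begin
      + a                                                ≡⟨ isolate (+ a) (+ z * + r (suc j)) ⟩
      (+ a + + z * + r (suc j)) - + z * + r (suc j)      ≡⟨ cong (λ x → x - + z * + r (suc j)) a+zr≡rℤ ⟩
      + r j - + z * + r (suc j)                          ≈⟨ minus-cong r[j]≈ (*-congˡ (+ z) r[1+j]≈) ⟩
      e * (+ s j * + q) - + z * (ε (suc (suc j)) * (+ s (suc j) * + q))
        ≡⟨ cong (λ c → e * (+ s j * + q) - + z * (c * (+ s (suc j) * + q))) (ε-suc (suc j)) ⟩
      e * (+ s j * + q) - + z * (- e * (+ s (suc j) * + q)) ≡⟨ collect e (+ s j) (+ z) (+ s (suc j)) (+ q) ⟩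
      e * ((+ s j + + z * + s (suc j)) * + q)            ≡⟨ cong (λ x → e * (x * + q)) (pos-+-* (s j) z (s (suc j))) ⟨
      e * (+ (s j ℕ.+ z ℕ.* s (suc j)) * + q)            ∎
      where
      open import Relation.Binary.Reasoning.Setoid ≈-setoid
      e : ℤ
      e = ε (suc j)
      a+zr≡rℤ : + a + + z * + r (suc j) ≡ + r j
      a+zr≡rℤ = trans (sym (pos-+-* a z (r (suc j)))) (cong +_ a+zr≡r)
      isolate : ∀ a b → a ≡ (a + b) - b
      isolate = solve-∀
      collect : ∀ e s z s′ q → e * (s * q) - z * (- e * (s′ * q)) ≡ e * ((s + z * s′) * q)
      collect = solve-∀

    r≈εsq-pair : ∀ j → j ≤ t → (+ r j ≈ ε (suc j) * (+ s j * + q)) × (+ r (suc j) ≈ ε (suc (suc j)) * (+ s (suc j) * + q))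
    r≈εsq-pair zero _ = ≈-trans (≈-reflexive (cong +_ r0≡p)) p≈0 , (begin
      + r 1           ≈⟨ cancelʳ-≈ (trans (ℕ.+-comm (r 1) _) (trans (sym (proj₂ q≡kp+r1)) (sym (ℕ.+-identityʳ q))))
                                   (nat-multiple≈0 (proj₁ q≡kp+r1)) ⟩
      + q             ≡⟨ unit (+ q) ⟩
      1ℤ * (+ 1 * + q) ∎)
      where
      open import Relation.Binary.Reasoning.Setoid ≈-setoid
      unit : ∀ x → x ≡ 1ℤ * (1ℤ * x)
      unit = solve-∀
    r≈εsq-pair (suc j) 1+j≤t with r≈εsq-pair j (ℕ.<⇒≤ 1+j≤t)
    ... | r[j]≈ , r[1+j]≈ = r[1+j]≈ , partial-remainder≈ j (Z (suc j)) r[j]≈ r[1+j]≈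
                                       (trans (ℕ.+-comm _ (Z (suc j) ℕ.* r (suc j))) (sym (proj₁ (step j 1+j≤t))))

  r≈εsq : ∀ j → j ≤ suc t → + r j ≈ ε (suc j) * (+ s j * + q)
  r≈εsq zero    _       = proj₁ (r≈εsq-pair 0 z≤n)
  r≈εsq (suc j) 1+j≤1+t = proj₂ (r≈εsq-pair j (ℕ.≤-pred 1+j≤1+t))

  IntermediateRemainder : ℕ → Set
  IntermediateRemainder A = ∃[ j ] ∃[ z ] (j < t × z < Z (suc j) × A ℕ.+ z ℕ.* r (suc j) ≡ r j)

  remainder-bounds : ∀ {A} → IntermediateRemainder A → 1 ≤ A × A ≤ p
  remainder-bounds {A} (j , z , j<t , z<Z , A+zr≡r) = 1≤A , A≤p
    where
    A≡r∸zr : A ≡ r j ∸ z ℕ.* r (suc j)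
    A≡r∸zr = trans (sym (ℕ.m+n∸n≡m A (z ℕ.* r (suc j)))) (cong (_∸ z ℕ.* r (suc j)) A+zr≡r)
    1≤A : 1 ≤ A
    1≤A = ℕ.≤-trans (ℕ.≤-trans (r-positive (suc j) j<t) (ℕ.m≤m+n (r (suc j)) (r (suc (suc j)))))
                    (subst (r (suc j) ℕ.+ r (suc (suc j)) ≤_) (sym A≡r∸zr) (r[1+j]+r[2+j]≤ j<t z<Z))
    A≤p : A ≤ p
    A≤p = ℕ.≤-trans (ℕ.≤-trans (ℕ.m≤m+n A _) (ℕ.≤-reflexive A+zr≡r)) (r≤p j (ℕ.<⇒≤ j<t))

  module PartialQuotient {j z A : ℕ} (j<t : j < t) (A+zr≡r : A ℕ.+ z ℕ.* r (suc j) ≡ r j) where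
    σ : ℕ
    σ = s j ℕ.+ z ℕ.* s (suc j)

    determinant : σ ℕ.* r (suc j) ℕ.+ s (suc j) ℕ.* A ≡ p
    determinant = begin
      σ ℕ.* r (suc j) ℕ.+ s (suc j) ℕ.* A
        ≡⟨ rearrange (s j) z (s (suc j)) (r (suc j)) A ⟩
      s j ℕ.* r (suc j) ℕ.+ s (suc j) ℕ.* (A ℕ.+ z ℕ.* r (suc j))
        ≡⟨ cong (λ x → s j ℕ.* r (suc j) ℕ.+ s (suc j) ℕ.* x) A+zr≡r ⟩
      s j ℕ.* r (suc j) ℕ.+ s (suc j) ℕ.* r j
        ≡⟨ s-determinant j (ℕ.<⇒≤ j<t) ⟩
      p ∎
      where
      open ≡-Reasoning
      rearrange : ∀ a z b R A → (a ℕ.+ z ℕ.* b) ℕ.* R ℕ.+ b ℕ.* A ≡ a ℕ.* R ℕ.+ b ℕ.* (A ℕ.+ z ℕ.* R)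
      rearrange = NS.solve-∀

    private
      r[1+j]≈ : + r (suc j) ≈ ε (suc (suc j)) * (+ s (suc j) * + q)
      r[1+j]≈ = r≈εsq (suc j) (ℕ.≤-trans j<t (ℕ.n≤1+n t))

    A≈εσq : + A ≈ ε (suc j) * (+ σ * + q)
    A≈εσq = partial-remainder≈ j z (r≈εsq j (ℕ.≤-trans (ℕ.<⇒≤ j<t) (ℕ.n≤1+n t))) r[1+j]≈ A+zr≡r

    least : ∀ {δ ρ} → 1 ≤ δ → δ < σ ℕ.+ s (suc j) → + ρ ≈ ε (suc j) * (+ δ * + q) → A ≤ ρ
    least {δ} {ρ} 1≤δ δ<σ+S ρ≈ =
      LeastResidue.least-residue p q (ε (suc j)) {σ} {s (suc j)} {r (suc j)} {A} determinant A≈εσq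
        (subst (λ c → + r (suc j) ≈ c * (+ s (suc j) * + q)) (ε-suc (suc j)) r[1+j]≈) ρ≈ 1≤δ (r-positive (suc j) j<t) δ<σ+S

  record MinResidue (c : ℤ) (δ : ℕ) : Set where
    field
      A σ       : ℕ
      remainder : IntermediateRemainder A
      σ≤δ       : σ ≤ δ
      A≈cσq     : + A ≈ c * (+ σ * + q)
      least     : Least c δ A

  private
    division-bounds : ∀ w S Zᵢ → 1 ≤ S → w < Zᵢ ℕ.* S → ∃[ z ] (z < Zᵢ × z ℕ.* S ≤ w × w < z ℕ.* S ℕ.+ S)
    division-bounds w S@(suc _) Zᵢ _ w<ZS = w / S , w/S<Z , w/S*S≤w , w<w/S*S+S
      where
      w/S*S≤w : w / S ℕ.* S ≤ w
      w/S*S≤w = m/n*n≤m w S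
      w<w/S*S+S : w < w / S ℕ.* S ℕ.+ S
      w<w/S*S+S = subst (_< w / S ℕ.* S ℕ.+ S) (sym (trans (m≡m%n+[m/n]*n w S) (ℕ.+-comm (w % S) _)))
                        (ℕ.+-monoʳ-< (w / S ℕ.* S) (m%n<n w S))
      w/S<Z : w / S < Zᵢ
      w/S<Z = ℕ.*-cancelʳ-< S (w / S) Zᵢ (ℕ.≤-<-trans w/S*S≤w w<ZS)

  -- The witness is r j - z r (j + 1) with z = ⌊(δ - s j) / s (j + 1)⌋.
  level-min-residue : ∀ j → j < t → ∀ δ → s j ≤ δ → δ < s (suc (suc j)) → MinResidue (ε (suc j)) δ
  level-min-residue j j<t δ s[j]≤δ δ<s[2+j] = record
    { A = A ; σ = σ ; remainder = j , z , j<t , z<Z , A+zr≡r ; σ≤δ = σ≤δ ; A≈cσq = A≈εσq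
    ; least = λ 1≤δ′ δ′≤δ → least 1≤δ′ (ℕ.≤-<-trans δ′≤δ δ<σ+S) }
    where
    S : ℕ
    S = s (suc j)
    w : ℕ
    w = δ ∸ s j
    s[j]+w≡δ : s j ℕ.+ w ≡ δ
    s[j]+w≡δ = ℕ.m+[n∸m]≡n s[j]≤δ
    w<ZS : w < Z (suc j) ℕ.* S
    w<ZS = ℕ.+-cancelˡ-< (s j) w _ (subst (_< s (suc (suc j))) (sym s[j]+w≡δ) δ<s[2+j])
    z : ℕ
    z = proj₁ (division-bounds w S (Z (suc j)) (s-positive j (ℕ.<⇒≤ j<t)) w<ZS)
    z<Z : z < Z (suc j)
    z<Z = proj₁ (proj₂ (division-bounds w S (Z (suc j)) (s-positive j (ℕ.<⇒≤ j<t)) w<ZS))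
    zS≤w : z ℕ.* S ≤ w
    zS≤w = proj₁ (proj₂ (proj₂ (division-bounds w S (Z (suc j)) (s-positive j (ℕ.<⇒≤ j<t)) w<ZS)))
    w<zS+S : w < z ℕ.* S ℕ.+ S
    w<zS+S = proj₂ (proj₂ (proj₂ (division-bounds w S (Z (suc j)) (s-positive j (ℕ.<⇒≤ j<t)) w<ZS)))
    A : ℕ
    A = r j ∸ z ℕ.* r (suc j)
    A+zr≡r : A ℕ.+ z ℕ.* r (suc j) ≡ r j
    A+zr≡r = ℕ.m∸n+n≡m (zr≤r j<t z<Z)
    open PartialQuotient {j} {z} {A} j<t A+zr≡r
    σ≤δ : σ ≤ δ
    σ≤δ = subst (σ ≤_) s[j]+w≡δ (ℕ.+-monoʳ-≤ (s j) zS≤w)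
    δ<σ+S : δ < σ ℕ.+ S
    δ<σ+S = subst (_< σ ℕ.+ S) s[j]+w≡δ
              (subst (s j ℕ.+ w <_) (sym (ℕ.+-assoc (s j) (z ℕ.* S) S)) (ℕ.+-monoʳ-< (s j) w<zS+S))

  min-residues-below : ∀ j → j < t → (∀ δ → 1 ≤ δ → δ < s (suc (suc j)) → MinResidue (ε (suc j)) δ)
                                    × (∀ δ → 1 ≤ δ → δ < s (suc j) → MinResidue (ε j) δ)
  min-residues-below zero    0<t =
    (λ δ _ → level-min-residue 0 0<t δ z≤n) , (λ δ 1≤δ δ<1 → ⊥-elim (ℕ.<⇒≱ δ<1 1≤δ))
  min-residues-below (suc j) 1+j<t = up-to-s[3+j] , proj₁ below-s[2+j]
    where
    below-s[2+j] : (∀ δ → 1 ≤ δ → δ < s (suc (suc j)) → MinResidue (ε (suc j)) δ)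
                 × (∀ δ → 1 ≤ δ → δ < s (suc j) → MinResidue (ε j) δ)
    below-s[2+j] = min-residues-below j (ℕ.<-trans (ℕ.n<1+n j) 1+j<t)
    up-to-s[3+j] : ∀ δ → 1 ≤ δ → δ < s (suc (suc (suc j))) → MinResidue (ε j) δ
    up-to-s[3+j] δ 1≤δ δ<s[3+j] with δ ℕ.<? s (suc j)
    ... | yes δ<s[1+j] = proj₂ below-s[2+j] δ 1≤δ δ<s[1+j]
    ... | no  δ≮s[1+j] = level-min-residue (suc j) 1+j<t δ (ℕ.≮⇒≥ δ≮s[1+j]) δ<s[3+j]

  -- Beyond s t the last remainder 1 = r (t - 1) - (Z t - 1) r t is the least possible residue.
  tail-min-residue : ∀ δ → s t ≤ δ → δ < p → MinResidue (ε (suc t)) δ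
  tail-min-residue δ s[t]≤δ δ<p = record
    { A = 1 ; σ = s t ; remainder = t₀ , Z t ∸ 1 , ℕ.≤-refl , Z[t]-1<Z[t] , last-remainder ; σ≤δ = s[t]≤δ
    ; A≈cσq = subst (λ n → + n ≈ ε (suc t) * (+ s t * + q)) r[t]≡1 (r≈εsq t (ℕ.n≤1+n t))
    ; least = least-one (Data.Sum.map proj₁ proj₁ (ε-cases (suc t))) δ<p }
    where
    1≤Z[t] : 1 ≤ Z t
    1≤Z[t] = Z-positive t₀ ℕ.≤-refl
    Z[t]-1<Z[t] : Z t ∸ 1 < Z t
    Z[t]-1<Z[t] = ℕ.∸-monoʳ-< {Z t} {1} {0} (s≤s z≤n) 1≤Z[t]
    last-remainder : 1 ℕ.+ (Z t ∸ 1) ℕ.* r t ≡ r t₀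
    last-remainder = begin
      1 ℕ.+ (Z t ∸ 1) ℕ.* r t ≡⟨ cong (λ x → 1 ℕ.+ (Z t ∸ 1) ℕ.* x) r[t]≡1 ⟩
      1 ℕ.+ (Z t ∸ 1) ℕ.* 1   ≡⟨ cong (1 ℕ.+_) (ℕ.*-identityʳ (Z t ∸ 1)) ⟩
      1 ℕ.+ (Z t ∸ 1)         ≡⟨ ℕ.m+[n∸m]≡n 1≤Z[t] ⟩
      Z t                     ≡⟨ r[t₀]≡Z[t] ⟨
      r t₀                    ∎
      where open ≡-Reasoning

  private
    min-residue-t : ∀ δ → 1 ≤ δ → δ < p → MinResidue (ε t) δ
    min-residue-t δ 1≤δ δ<p = proj₁ (min-residues-below t₀ ℕ.≤-refl) δ 1≤δ (subst (δ <_) (sym s[1+t]≡p) δ<p)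

    min-residue-1+t : ∀ δ → 1 ≤ δ → δ < p → MinResidue (ε (suc t)) δ
    min-residue-1+t δ 1≤δ δ<p with δ ℕ.<? s t
    ... | yes δ<s[t] = proj₂ (min-residues-below t₀ ℕ.≤-refl) δ 1≤δ δ<s[t]
    ... | no  δ≮s[t] = tail-min-residue δ (ℕ.≮⇒≥ δ≮s[t]) δ<p

  min-residues : ∀ δ → 1 ≤ δ → δ < p → MinResidue 1ℤ δ × MinResidue -1ℤ δ
  min-residues δ 1≤δ δ<p with ε-cases t
  ... | inj₁ (ε[t]≡1 , ε[1+t]≡-1) = subst (λ c → MinResidue c δ) ε[t]≡1 (min-residue-t δ 1≤δ δ<p)
                                   , subst (λ c → MinResidue c δ) ε[1+t]≡-1 (min-residue-1+t δ 1≤δ δ<p)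
  ... | inj₂ (ε[t]≡-1 , ε[1+t]≡1) = subst (λ c → MinResidue c δ) ε[1+t]≡1 (min-residue-1+t δ 1≤δ δ<p)
                                   , subst (λ c → MinResidue c δ) ε[t]≡-1 (min-residue-t δ 1≤δ δ<p)

  distance⇒remainder : ∀ {d} → Distance d → IntermediateRemainder d
  distance⇒remainder {d} (x , consecutive) with ℕ.<-cmp (qCoeff x) (qCoeff (x ℕ.+ d))
  ... | tri≈ _ i≡j _ = subst IntermediateRemainder (sym (distance-same-qCoeff consecutive i≡j))
                             (0 , 0 , s≤s z≤n , Z-positive 0 (s≤s z≤n) , trans (ℕ.+-identityʳ p) (sym r0≡p))
  ... | tri< i<j _ _ = subst IntermediateRemainder (sym d≡A) remainder
    where
    open MinResidue (proj₁ (min-residues (qCoeff (x ℕ.+ d) ∸ qCoeff x) (ℕ.m<n⇒0<n∸m i<j)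
                                         (ℕ.≤-<-trans (ℕ.m∸n≤m (qCoeff (x ℕ.+ d)) (qCoeff x)) (qCoeff<p (x ℕ.+ d)))))
    d≡A : d ≡ A
    d≡A = distance-up consecutive i<j (proj₁ (remainder-bounds remainder)) σ≤δ A≈cσq least
  ... | tri> _ _ j<i = subst IntermediateRemainder (sym d≡A) remainder
    where
    open MinResidue (proj₂ (min-residues (qCoeff x ∸ qCoeff (x ℕ.+ d)) (ℕ.m<n⇒0<n∸m j<i)
                                         (ℕ.≤-<-trans (ℕ.m∸n≤m (qCoeff x) (qCoeff (x ℕ.+ d))) (qCoeff<p x))))
    d≡A : d ≡ A
    d≡A = distance-down consecutive j<i (proj₁ (remainder-bounds remainder)) σ≤δ A≈cσq least

  remainder⇒distance : ∀ {A} → IntermediateRemainder A → Distance A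
  remainder⇒distance {A} remainder@(j , z , j<t , z<Z , A+zr≡r) = by-sign (ε-cases (suc j))
    where
    open PartialQuotient {j} {z} {A} j<t A+zr≡r
    1≤A : 1 ≤ A
    1≤A = proj₁ (remainder-bounds remainder)
    A≤p : A ≤ p
    A≤p = proj₂ (remainder-bounds remainder)
    σ<σ+S : σ < σ ℕ.+ s (suc j)
    σ<σ+S = ℕ.m<m+n σ (s-positive j (ℕ.<⇒≤ j<t))
    σ<p : σ < p
    σ<p = ℕ.<-≤-trans σ<σ+S (begin
      σ ℕ.+ s (suc j)                       ≡⟨ ℕ.+-assoc (s j) _ _ ⟩
      s j ℕ.+ (z ℕ.* s (suc j) ℕ.+ s (suc j)) ≡⟨ cong (s j ℕ.+_) (ℕ.+-comm _ (s (suc j))) ⟩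
      s j ℕ.+ suc z ℕ.* s (suc j)             ≤⟨ ℕ.+-monoʳ-≤ (s j) (ℕ.*-monoˡ-≤ (s (suc j)) z<Z) ⟩
      s (suc (suc j))                       ≤⟨ s≤p (suc j) j<t ⟩
      p                                     ∎)
      where open ℕ.≤-Reasoning
    A≈cσq : ∀ {c} → ε (suc j) ≡ c → + A ≈ c * (+ σ * + q)
    A≈cσq refl = A≈εσq
    least-below-σ : ∀ {c} → ε (suc j) ≡ c → Least c σ A
    least-below-σ refl 1≤δ′ δ′≤σ = least 1≤δ′ (ℕ.≤-<-trans δ′≤σ σ<σ+S)
    by-sign : (ε (suc j) ≡ 1ℤ × ε (suc (suc j)) ≡ -1ℤ) ⊎ (ε (suc j) ≡ -1ℤ × ε (suc (suc j)) ≡ 1ℤ) → Distance A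
    by-sign (inj₂ (ε≡-1 , _)) = σ ℕ.* q , residue-down⇒consecutive σ<p 1≤A A≤p (A≈cσq ε≡-1) (least-below-σ ε≡-1)
    by-sign (inj₁ (ε≡1 , _)) with σ ℕ.≟ 0
    ... | yes σ≡0 = 0 , residue-down⇒consecutive {A} {0} 0<p 1≤A A≤p
                          (subst (λ k → + A ≈ 1ℤ * (+ k * + q)) σ≡0 (A≈cσq ε≡1))
                          (λ 1≤δ′ δ′≤0 → ⊥-elim (ℕ.<⇒≱ 1≤δ′ δ′≤0))
    ... | no  σ≢0 = residue-up⇒distance (ℕ.n≢0⇒n>0 σ≢0) σ<p 1≤A A≤p (A≈cσq ε≡1) (least-below-σ ε≡1)

  distance⇔remainder : ∀ {d} → Distance d ⇔ IntermediateRemainder d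
  distance⇔remainder = mk⇔ distance⇒remainder remainder⇒distance

  -- The paper's G₁ ∪ … ∪ G_t, with G_i indexed by i = j + 1.
  InG : ℕ → Set
  InG g = (∃[ i ] (1 ≤ i × i < t × ∃[ z ] (z < Z i × g ≡ r (i ∸ 1) ∸ z ℕ.* r i ∸ 1)))
          ⊎ (∃[ z ] (z ℕ.+ 2 ≤ Z t × g ≡ r (t ∸ 1) ∸ z ℕ.* r t ∸ 1))

  value : ℕ → ℕ → ℕ
  value j z = r j ∸ z ℕ.* r (suc j) ∸ 1

  private
    value-remainder : ∀ {j z} → j < t → z < Z (suc j) → 2 ≤ r j ∸ z ℕ.* r (suc j) →
                      1 ≤ value j z × IntermediateRemainder (suc (value j z))
    value-remainder {j} {z} j<t z<Z 2≤X = ℕ.∸-monoˡ-≤ 1 2≤X , j , z , j<t , z<Z , (begin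
      suc (r j ∸ z ℕ.* r (suc j) ∸ 1) ℕ.+ z ℕ.* r (suc j)
        ≡⟨ cong (ℕ._+ z ℕ.* r (suc j)) (ℕ.m+[n∸m]≡n (ℕ.≤-trans (s≤s z≤n) 2≤X)) ⟩
      r j ∸ z ℕ.* r (suc j) ℕ.+ z ℕ.* r (suc j)         ≡⟨ ℕ.m∸n+n≡m (zr≤r j<t z<Z) ⟩
      r j                                               ∎)
      where open ≡-Reasoning

    remainder-value : ∀ {g j z} → suc g ℕ.+ z ℕ.* r (suc j) ≡ r j → g ≡ value j z
    remainder-value {g} {j} {z} 1+g+zr≡r =
      sym (cong (_∸ 1) (trans (cong (_∸ z ℕ.* r (suc j)) (sym 1+g+zr≡r)) (ℕ.m+n∸n≡m (suc g) (z ℕ.* r (suc j)))))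

  InG⇔remainder : ∀ g → InG g ⇔ (1 ≤ g × IntermediateRemainder (suc g))
  InG⇔remainder g = mk⇔ to from
    where
    to : InG g → 1 ≤ g × IntermediateRemainder (suc g)
    to (inj₁ (suc j , _ , s≤s j<t₀ , z , z<Z , refl)) = value-remainder j<t z<Z
      (ℕ.≤-trans (ℕ.+-mono-≤ (r-positive (suc j) j<t) (r-positive (suc (suc j)) (s≤s j<t₀))) (r[1+j]+r[2+j]≤ j<t z<Z))
      where
      j<t : j < t
      j<t = ℕ.<-trans j<t₀ ℕ.≤-refl
    to (inj₂ (z , z+2≤Z[t] , refl)) = value-remainder ℕ.≤-refl (ℕ.<-≤-trans (ℕ.m<m+n z (s≤s z≤n)) z+2≤Z[t]) (begin
      2                         ≤⟨ ℕ.m+n≤o⇒m≤o∸n 2 (subst (_≤ Z t) (ℕ.+-comm z 2) z+2≤Z[t]) ⟩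
      Z t ∸ z                   ≡⟨ cong₂ _∸_ r[t₀]≡Z[t] (trans (cong (z ℕ.*_) r[t]≡1) (ℕ.*-identityʳ z)) ⟨
      r t₀ ∸ z ℕ.* r t          ∎)
      where open ℕ.≤-Reasoning
    from : 1 ≤ g × IntermediateRemainder (suc g) → InG g
    from (1≤g , j , z , j<t , z<Z , 1+g+zr≡r) with j ℕ.<? t₀
    ... | yes j<t₀ = inj₁ (suc j , s≤s z≤n , s≤s j<t₀ , z , z<Z , remainder-value {g} {j} {z} 1+g+zr≡r)
    ... | no  j≮t₀ with ℕ.≤-antisym (ℕ.≤-pred j<t) (ℕ.≮⇒≥ j≮t₀)
    ...   | refl = inj₂ (z , z+2≤Z[t] , remainder-value {g} {t₀} {z} 1+g+zr≡r)
      where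
      z+2≤Z[t] : z ℕ.+ 2 ≤ Z t
      z+2≤Z[t] = begin
        z ℕ.+ 2                  ≡⟨ ℕ.+-comm z 2 ⟩
        2 ℕ.+ z                  ≤⟨ ℕ.+-monoˡ-≤ z (s≤s 1≤g) ⟩
        suc g ℕ.+ z              ≡⟨ cong (suc g ℕ.+_) (trans (cong (z ℕ.*_) r[t]≡1) (ℕ.*-identityʳ z)) ⟨
        suc g ℕ.+ z ℕ.* r t      ≡⟨ 1+g+zr≡r ⟩
        r j                      ≡⟨ r[t₀]≡Z[t] ⟩
        Z t                      ∎
        where open ℕ.≤-Reasoning

  level : ℕ → ℕ → List ℕ
  level j n = applyUpTo (value j) n

  levels : ℕ → List ℕ
  levels zero    = []
  levels (suc k) = levels k ++ level k (Z (suc k))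

  gaps : List ℕ
  gaps = levels t₀ ++ level t₀ (Z t ∸ 1)

  ∈-level : ∀ {g j n} → g ∈ level j n ⇔ (∃[ z ] (z < n × g ≡ value j z))
  ∈-level {j = j} = mk⇔ (∈-applyUpTo⁻ (value j)) (λ { (z , z<n , refl) → ∈-applyUpTo⁺ (value j) z<n })

  ∈-levels : ∀ k {g} → g ∈ levels k ⇔ (∃[ j ] (j < k × ∃[ z ] (z < Z (suc j) × g ≡ value j z)))
  ∈-levels k = mk⇔ (to k) (from k)
    where
    to : ∀ k {g} → g ∈ levels k → ∃[ j ] (j < k × ∃[ z ] (z < Z (suc j) × g ≡ value j z))
    to (suc k) g∈ with ∈-++⁻ (levels k) g∈
    ... | inj₁ g∈levels = let (j , j<k , rest) = to k g∈levels in j , ℕ.m<n⇒m<1+n j<k , rest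
    ... | inj₂ g∈level  = k , ℕ.≤-refl , Equivalence.to ∈-level g∈level
    from : ∀ k {g} → ∃[ j ] (j < k × ∃[ z ] (z < Z (suc j) × g ≡ value j z)) → g ∈ levels k
    from (suc k) (j , j<1+k , rest) with ℕ.m≤n⇒m<n∨m≡n (ℕ.≤-pred j<1+k)
    ... | inj₁ j<k  = ∈-++⁺ˡ (from k (j , j<k , rest))
    ... | inj₂ refl = ∈-++⁺ʳ (levels k) (Equivalence.from ∈-level rest)

  ∈-gaps : ∀ g → g ∈ gaps ⇔ InG g
  ∈-gaps g = mk⇔ to from
    where
    shift : ∀ z → z ℕ.+ 2 ≡ suc z ℕ.+ 1
    shift = NS.solve-∀
    to : g ∈ gaps → InG g
    to g∈ with ∈-++⁻ (levels t₀) g∈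
    ... | inj₁ g∈levels = let (j , j<t₀ , z , rest) = Equivalence.to (∈-levels t₀) g∈levels in
      inj₁ (suc j , s≤s z≤n , s≤s j<t₀ , z , rest)
    ... | inj₂ g∈level  = let (z , z<Z[t]-1 , g≡) = Equivalence.to ∈-level g∈level in
      inj₂ (z , subst (_≤ Z t) (sym (shift z)) (ℕ.m≤o∸n⇒m+n≤o (suc z) (Z-positive t₀ ℕ.≤-refl) z<Z[t]-1) , g≡)
    from : InG g → g ∈ gaps
    from (inj₁ (suc j , _ , s≤s j<t₀ , rest)) = ∈-++⁺ˡ (Equivalence.from (∈-levels t₀) (j , j<t₀ , rest))
    from (inj₂ (z , z+2≤Z[t] , g≡)) = ∈-++⁺ʳ (levels t₀) (Equivalence.from ∈-level
      (z , ℕ.m+n≤o⇒m≤o∸n (suc z) (subst (_≤ Z t) (shift z) z+2≤Z[t]) , g≡))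

  private
    remainder≥1 : ∀ {j z} → j < t → z < Z (suc j) → 1 ≤ r j ∸ z ℕ.* r (suc j)
    remainder≥1 {j} j<t z<Z = ℕ.≤-trans (r-positive (suc j) j<t) (ℕ.≤-trans (ℕ.m≤m+n _ _) (r[1+j]+r[2+j]≤ j<t z<Z))

  value-decreasing : ∀ {j a c} → j < t → a < c → c < Z (suc j) → value j c < value j a
  value-decreasing {j} {a} {c} j<t a<c c<Z = ℕ.∸-monoˡ-< (ℕ.∸-monoʳ-< ar<cr (zr≤r j<t c<Z)) (remainder≥1 j<t c<Z)
    where
    ar<cr : a ℕ.* r (suc j) < c ℕ.* r (suc j)
    ar<cr = ℕ.*-monoˡ-< (r (suc j)) ⦃ ℕ.>-nonZero (r-positive (suc j) j<t) ⦄ a<c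

  value<r : ∀ {j} z → j < t → value j z < r j
  value<r {j} z j<t = ℕ.≤-<-trans (ℕ.∸-monoˡ-≤ 1 (ℕ.m∸n≤m (r j) (z ℕ.* r (suc j))))
                                  (ℕ.∸-monoʳ-< {r j} {1} {0} (s≤s z≤n) (r-positive j (ℕ.<⇒≤ j<t)))

  r≤value : ∀ {j z} → suc j < t → z < Z (suc j) → r (suc j) ≤ value j z
  r≤value {j} {z} 1+j<t z<Z = ℕ.m+n≤o⇒m≤o∸n (r (suc j))
    (ℕ.≤-trans (ℕ.+-monoʳ-≤ (r (suc j)) (r-positive (suc (suc j)) 1+j<t)) (r[1+j]+r[2+j]≤ (ℕ.<-trans (ℕ.n<1+n j) 1+j<t) z<Z))

  r≤levels : ∀ k → k ≤ t₀ → ∀ {g} → g ∈ levels k → r k ≤ g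
  r≤levels (suc k) 1+k≤t₀ g∈ with ∈-++⁻ (levels k) g∈
  ... | inj₁ g∈levels =
    ℕ.≤-trans (ℕ.<⇒≤ (r-decreasing k (ℕ.<-trans 1+k≤t₀ ℕ.≤-refl))) (r≤levels k (ℕ.<⇒≤ 1+k≤t₀) g∈levels)
  ... | inj₂ g∈level with ∈-applyUpTo⁻ (value k) g∈level
  ...   | z , z<Z , refl = r≤value (s≤s 1+k≤t₀) z<Z

  level<r : ∀ {j n g} → j < t → g ∈ level j n → g < r j
  level<r {j} j<t g∈ with ∈-applyUpTo⁻ (value j) g∈
  ... | z , _ , refl = value<r z j<t

  unique-level : ∀ {j n} → j < t → n ≤ Z (suc j) → Unique (level j n)
  unique-level {j} {n} j<t n≤Z = Unique.applyUpTo⁺₁ (value j) n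
    (λ a<c c<n value≡ → ℕ.<-irrefl (sym value≡) (value-decreasing j<t a<c (ℕ.<-≤-trans c<n n≤Z)))

  unique-levels : ∀ k → k ≤ t₀ → Unique (levels k)
  unique-levels zero    _      = AllPairs.[]
  unique-levels (suc k) 1+k≤t₀ = Unique.++⁺ (unique-levels k (ℕ.<⇒≤ 1+k≤t₀)) (unique-level k<t ℕ.≤-refl)
    (λ (g∈levels , g∈level) → ℕ.<⇒≱ (level<r k<t g∈level) (r≤levels k (ℕ.<⇒≤ 1+k≤t₀) g∈levels))
    where
    k<t : k < t
    k<t = ℕ.<-trans 1+k≤t₀ ℕ.≤-refl

  unique-gaps : Unique gaps
  unique-gaps = Unique.++⁺ (unique-levels t₀ ℕ.≤-refl) (unique-level ℕ.≤-refl (ℕ.m∸n≤m (Z t) 1))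
    (λ (g∈levels , g∈level) → ℕ.<⇒≱ (level<r ℕ.≤-refl g∈level) (r≤levels t₀ ℕ.≤-refl g∈levels))

  ΣZ-suc : ∀ k → ΣZ Z (suc k) ≡ ΣZ Z k ℕ.+ Z (suc k)
  ΣZ-suc k = begin
    sum (applyUpTo (λ i → Z (suc i)) (suc k))           ≡⟨ cong sum (applyUpTo-∷ʳ (λ i → Z (suc i)) k) ⟨
    sum (applyUpTo (λ i → Z (suc i)) k ++ Z (suc k) ∷ []) ≡⟨ sum-++ (applyUpTo (λ i → Z (suc i)) k) _ ⟩
    ΣZ Z k ℕ.+ (Z (suc k) ℕ.+ 0)                         ≡⟨ cong (ΣZ Z k ℕ.+_) (ℕ.+-identityʳ (Z (suc k))) ⟩
    ΣZ Z k ℕ.+ Z (suc k)                                 ∎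
    where open ≡-Reasoning

  length-levels : ∀ k → length (levels k) ≡ ΣZ Z k
  length-levels zero    = refl
  length-levels (suc k) = begin
    length (levels k ++ level k (Z (suc k)))        ≡⟨ length-++ (levels k) ⟩
    length (levels k) ℕ.+ length (level k (Z (suc k)))
      ≡⟨ cong₂ ℕ._+_ (length-levels k) (length-applyUpTo (value k) (Z (suc k))) ⟩
    ΣZ Z k ℕ.+ Z (suc k)                            ≡⟨ ΣZ-suc k ⟨
    ΣZ Z (suc k)                                    ∎
    where open ≡-Reasoning

  length-gaps : length gaps ≡ ΣZ Z t ∸ 1
  length-gaps = begin
    length (levels t₀ ++ level t₀ (Z t ∸ 1))         ≡⟨ length-++ (levels t₀) ⟩
    length (levels t₀) ℕ.+ length (level t₀ (Z t ∸ 1))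
      ≡⟨ cong₂ ℕ._+_ (length-levels t₀) (length-applyUpTo (value t₀) (Z t ∸ 1)) ⟩
    ΣZ Z t₀ ℕ.+ (Z t ∸ 1)                            ≡⟨ ℕ.+-∸-assoc (ΣZ Z t₀) (Z-positive t₀ ℕ.≤-refl) ⟨
    ΣZ Z t₀ ℕ.+ Z t ∸ 1                              ≡⟨ cong (_∸ 1) (ΣZ-suc t₀) ⟨
    ΣZ Z t ∸ 1                                       ∎
    where open ≡-Reasoning

open import Data.Nat.Base using (_+_; _*_)
open import Data.Product using (Σ)
open import Data.Product.Function.NonDependent.Propositional using (_×-⇔_)
open import Data.List.Base using (List; length)
open import Data.List.Relation.Unary.Unique.Propositional using (Unique)
open import Data.List.Membership.Propositional using (_∈_)

theorem2 : (p q : ℕ) → 3 ≤ p → p ≤ q → Coprime p q →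
    (f : Poly) → IsQ p q f →
    (t : ℕ) (r Z : ℕ → ℕ) →
    r 0 ≡ p → r 1 < p → (∃[ k ] q ≡ k * p + r 1) →
    (∀ i → 1 ≤ i → i ≤ t → r (i ∸ 1) ≡ Z i * r i + r (suc i) × r (suc i) < r i) →
    r t ≡ 1 →
    ((∀ g → InGapset f g ⇔
        ((∃[ i ] (1 ≤ i × i < t × ∃[ z ] (z < Z i × g ≡ r (i ∸ 1) ∸ z * r i ∸ 1)))
        ⊎ (∃[ z ] (z + 2 ≤ Z t × g ≡ r (t ∸ 1) ∸ z * r t ∸ 1))))
    × Σ (List ℕ) (λ L → Unique L × (∀ g → g ∈ L ⇔ InGapset f g) × length L ≡ ΣZ Z t ∸ 1))
theorem2 p q 3≤p p≤q p⊥q f isQ zero r Z r0≡p _ _ _ r0≡1 =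
  ⊥-elim (ℕ.<⇒≢ (ℕ.≤-trans (s≤s (s≤s z≤n)) 3≤p) (trans (sym r0≡1) r0≡p))
theorem2 p q 3≤p p≤q p⊥q f isQ (suc t₀) r Z r0≡p r1<p q≡kp+r1 division r[t]≡1 =
  gapset , gaps , unique-gaps , (λ g → ⇔.trans (∈-gaps g) (⇔.sym (gapset g))) , length-gaps
  where
  1<p : 1 < p
  1<p = ℕ.≤-trans (s≤s (s≤s z≤n)) 3≤p
  open Gaps p q 1<p p≤q p⊥q f isQ using (gap⇔distance)
  open Euclid p q 1<p p≤q p⊥q t₀ r Z r0≡p r1<p q≡kp+r1 division r[t]≡1
  gapset : ∀ g → InGapset f g ⇔ InG g
  gapset g = ⇔.trans (gap⇔distance g) (⇔.trans (⇔.refl ×-⇔ distance⇔remainder) (⇔.sym (InG⇔remainder g)))
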